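{- Let $V$ be a finite set of Boolean variables, let $\circ\in\{\wedge,\vee\}$, and suppose all formulas occurring on the left- and right-hand sides below are DQBFs in $\mathcal{D}$ over $V$ (as defined in the context). Let $x'$ and $y'$ be fresh variables not occurring in $\varphi,\varphi_1,\varphi_2$. Then: (a) $\exists y(D_y):\varphi\ \equiv\ \varphi$; (b) $\forall x:\varphi\ \approx\ \varphi^{ -x}$ if $x\notin V_\varphi$; (c) $\forall x:\varphi\ \equiv\ \varphi[0/x]\wedge\varphi[1/x]$ if $V^\forall_\varphi=V^\exists_\varphi=\emptyset$; (d) $\exists y(D_y):\varphi\ \approx\ \varphi[0/y]\vee\varphi[1/y]$ if $V^\forall_\varphi=V^\exists_\varphi=\emptyset$; (e) $\forall x:(\varphi_1\wedge\varphi_2)\ \approx\ (\forall x:\varphi_1)\wedge(\forall x':\varphi_2[x'/x])$, where $\varphi_2[x'/x]$ replaces all occurrences of $x$ by $x'$, including occurrences in dependency sets; (f) $\forall x:(\varphi_1\wedge\varphi_2)\ \approx\ (\varphi_1^{ -x}\wedge(\forall x:\varphi_2))$ if $x\notin V_{\varphi_1}$; (g) $\forall x:(\varphi_1\circ\varphi_2)\ \equiv\ (\varphi_1\circ(\forall x:\varphi_2))$ if $x\notin V_{\varphi_1}$ and $x\notin D_y$ for all $y\in V^\exists_{\varphi_1}$; (h) $\exists y(D_y):(\varphi_1\vee\varphi_2)\ \approx\ (\exists y(D_y):\varphi_1)\vee(\exists y'(D_y):\varphi_2[y'/y])$; (i) $\exists y(D_y):(\varphi_1\circ\varphi_2)\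 \equiv\ (\varphi_1\circ(\exists y(D_y):\varphi_2))$ if $y\notin V_{\varphi_1}$; (j) $\exists y_1(D_{y_1})\,\exists y_2(D_{y_2}):\varphi\ \equiv\ \exists y_2(D_{y_2})\,\exists y_1(D_{y_1}):\varphi$; (k) $\forall x_1\,\forall x_2:\varphi\ \equiv\ \forall x_2\,\forall x_1:\varphi$; (l) $\forall x\,\exists y(D_y):\varphi\ \equiv\ \exists y(D_y)\,\forall x:\varphi$ if $x\notin D_y$.
   Context: Notation: for a set $W$ of Boolean variables, $\mathcal{F}(W)$ is the set of Boolean functions on assignments $W\to\{0,1\}$; $\mathrm{supp}(f)$ is the set of variables on which $f$ actually depends; $\mathbf{0},\mathbf{1}$ are constant functions; $\varphi[\kappa/v]$ denotes simultaneous replacement of $v$ by $\kappa$ in $\varphi$. Syntax (non-closed non-prenex DQBFs in NNF over a finite variable set $V$). The set $\mathcal{D}$, together with for each $\psi$ the sets $V^{\exists}_\psi$ (existential), $V^{\forall}_\psi$ (universal), $V^{\mathrm{fs}}_\psi$ (free variables occurring in $\psi$), and a dependency set $D_y\subseteq V$ for each existential variable $y$, is the smallest set closed under: (1) $v\in\mathcal{D}$ for $v\in V$, with $V^\exists=V^\forall=\emptyset$, $V^{\mathrm{fs}}=\{v\}$; (2) $\neg v\in\mathcal{D}$, same sets; (3),(4) if $\varphi_1,\varphi_2\in\mathcal{D}$ and $\bigl(V^Q_{\varphi_1}\cup V^{\mathrm{fs}}_{\varphi_1}\cup\bigcup_{y\in V^\exists_{\varphi_1}}D_y\bigr)\cap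 V^Q_{\varphi_2}=\emptyset$ and symmetrically with $1,2$ swapped, then $(\varphi_1\wedge\varphi_2),(\varphi_1\vee\varphi_2)\in\mathcal{D}$ with $V^\exists$, $V^\forall$, $V^{\mathrm{fs}}$ the unions of those of the parts; (5) if $\varphi\in\mathcal{D}$, $v\in V^{\mathrm{free}}_\varphi$, $D_v\subseteq V\setminus(V^Q_\varphi\cup\{v\})$, then $\exists v(D_v):\varphi^{ -v}\in\mathcal{D}$, where $\varphi^{ -v}$ is $\varphi$ with $v$ removed from the dependency sets of all its existential variables; $V^\exists=V^\exists_\varphi\cup\{v\}$, $V^\forall=V^\forall_\varphi$, $V^{\mathrm{fs}}=V^{\mathrm{fs}}_\varphi\setminus\{v\}$; (6) if $\varphi\in\mathcal{D}$, $v\in V^{\mathrm{free}}_\varphi$, then $\forall v:\varphi\in\mathcal{D}$ with $V^\forall=V^\forall_\varphi\cup\{v\}$, $V^\exists=V^\exists_\varphi$, $V^{\mathrm{fs}}=V^{\mathrm{fs}}_\varphi\setminus\{v\}$. Here $V^Q_\psi=V^\exists_\psi\cup V^\forall_\psi$, $V_\psi=V^Q_\psi\cup V^{\mathrm{fs}}_\psi$, $V^{\mathrm{free}}_\psi=V\setminus V^Q_\psi$. Semantics. A Skolem function candidate for $\psi$ is a map $s:V^{\mathrm{free}}_\psi\cup V^\exists_\psi\to\mathcal{F}(V^\forall_\psi)$ with $s(v)$ constant for free $v$ and $\mathrm{supp}(s(v))\subseteq D_v\cap V^\forall_\psi$ for existential $v$; $\mathcal{S}_\psi$ is the set of these. $s(\psi)$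 is obtained by replacing each $v$ in the domain of $s$ by $s(v)$ and deleting all quantifiers. $[\![\psi]\!]=\{s\in\mathcal{S}_\psi\mid s(\psi)\text{ is a tautology}\}$; $\psi$ is satisfiable iff $[\![\psi]\!]\neq\emptyset$. Two DQBFs are equivalent ($\psi_1\equiv\psi_2$) if $[\![\psi_1]\!]=[\![\psi_2]\!]$, and equisatisfiable ($\psi_1\approx\psi_2$) if $[\![\psi_1]\!]=\emptyset\iff[\![\psi_2]\!]=\emptyset$. -}

module Defs where

open import Data.Nat using (ℕ)
open import Data.Fin using (Fin)
open import Data.Fin.Properties using (_≟_)
open import Data.Fin.Subset using (Subset; _∈_; _∉_; _∪_; _∩_; _-_; ⁅_⁆) renaming (⊥ to ∅)
open import Data.Bool using (Bool; true; false; not; _∧_; _∨_; if_then_else_)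
open import Data.Vec using (lookup)
open import Data.Product using (Σ; _×_; _,_)
open import Data.Sum using (_⊎_)
open import Data.Empty using (⊥)
open import Function.Bundles using (_⇔_)
open import Relation.Nullary using (¬_; does)
open import Relation.Binary.PropositionalEquality using (_≡_; _≢_)

-- Raw syntax of (non-closed, non-prenex) DQBFs in NNF.  The dependency
-- set of an existential variable is stored at its quantifier node.
-- Constants 0/1 are included so that φ[0/x], φ[1/x] are formulas.

data Conn : Set where
  ∧c ∨c : Conn

data DQBF (n : ℕ) : Set where
  cst  : Bool → DQBF n
  pos  : Fin n → DQBF n
  neg  : Fin n → DQBF n
  and  : DQBF n → DQBF n → DQBF n
  or   : DQBF n → DQBF n → DQBF n
  exQ  : Fin n → Subset n → DQBF n → DQBF n
  allQ : Fin n → DQBF n → DQBF n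

private
  variable
    n : ℕ

conn : Conn → DQBF n → DQBF n → DQBF n
conn ∧c = and
conn ∨c = or

exVars : DQBF n → Subset n
exVars (cst _)      = ∅
exVars (pos _)      = ∅
exVars (neg _)      = ∅
exVars (and φ ψ)    = exVars φ ∪ exVars ψ
exVars (or φ ψ)     = exVars φ ∪ exVars ψ
exVars (exQ v _ φ)  = exVars φ ∪ ⁅ v ⁆
exVars (allQ _ φ)   = exVars φ

allVars : DQBF n → Subset n
allVars (cst _)     = ∅
allVars (pos _)     = ∅
allVars (neg _)     = ∅
allVars (and φ ψ)   = allVars φ ∪ allVars ψ
allVars (or φ ψ)    = allVars φ ∪ allVars ψ
allVars (exQ _ _ φ) = allVars φ
allVars (allQ v φ)  = allVars φ ∪ ⁅ v ⁆

fsVars : DQBF n → Subset n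
fsVars (cst _)      = ∅
fsVars (pos v)      = ⁅ v ⁆
fsVars (neg v)      = ⁅ v ⁆
fsVars (and φ ψ)    = fsVars φ ∪ fsVars ψ
fsVars (or φ ψ)     = fsVars φ ∪ fsVars ψ
fsVars (exQ v _ φ)  = fsVars φ - v
fsVars (allQ v φ)   = fsVars φ - v

depVars : DQBF n → Subset n
depVars (cst _)     = ∅
depVars (pos _)     = ∅
depVars (neg _)     = ∅
depVars (and φ ψ)   = depVars φ ∪ depVars ψ
depVars (or φ ψ)    = depVars φ ∪ depVars ψ
depVars (exQ _ D φ) = D ∪ depVars φ
depVars (allQ _ φ)  = depVars φ

qVars : DQBF n → Subset n
qVars φ = exVars φ ∪ allVars φ

occVars : DQBF n → Subset n
occVars φ = qVars φ ∪ fsVars φ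

BindsEx : DQBF n → Fin n → Subset n → Set
BindsEx (cst _)      y D = ⊥
BindsEx (pos _)      y D = ⊥
BindsEx (neg _)      y D = ⊥
BindsEx (and φ ψ)    y D = BindsEx φ y D ⊎ BindsEx ψ y D
BindsEx (or φ ψ)     y D = BindsEx φ y D ⊎ BindsEx ψ y D
BindsEx (exQ v D' φ) y D = (v ≡ y × D' ≡ D) ⊎ BindsEx φ y D
BindsEx (allQ _ φ)   y D = BindsEx φ y D

removeDep : Fin n → DQBF n → DQBF n
removeDep v (cst b)      = cst b
removeDep v (pos u)      = pos u
removeDep v (neg u)      = neg u
removeDep v (and φ ψ)    = and (removeDep v φ) (removeDep v ψ)
removeDep v (or φ ψ)     = or (removeDep v φ) (removeDep v ψ)
removeDep v (exQ y D φ)  = exQ y (D - v) (removeDep v φ)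
removeDep v (allQ x φ)   = allQ x (removeDep v φ)

-- The formula written  ∃v(D):φ  in the paper, i.e. rule (5): ∃v(D):φ^{-v}
Ex : Fin n → Subset n → DQBF n → DQBF n
Ex v D φ = exQ v D (removeDep v φ)

All : Fin n → DQBF n → DQBF n
All = allQ

substConst : Fin n → Bool → DQBF n → DQBF n
substConst v b (cst c)     = cst c
substConst v b (pos u)     = if does (u ≟ v) then cst b else pos u
substConst v b (neg u)     = if does (u ≟ v) then cst (not b) else neg u
substConst v b (and φ ψ)   = and (substConst v b φ) (substConst v b ψ)
substConst v b (or φ ψ)    = or (substConst v b φ) (substConst v b ψ)
substConst v b (exQ y D φ) = exQ y D (substConst v b φ)
substConst v b (allQ x φ)  = allQ x (substConst v b φ)

renameVar : Fin n → Fin n → Fin n → Fin n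
renameVar v w u = if does (u ≟ v) then w else u

renameSet : Fin n → Fin n → Subset n → Subset n
renameSet v w D = if lookup D v then (D - v) ∪ ⁅ w ⁆ else D

rename : Fin n → Fin n → DQBF n → DQBF n
rename v w (cst c)     = cst c
rename v w (pos u)     = pos (renameVar v w u)
rename v w (neg u)     = neg (renameVar v w u)
rename v w (and φ ψ)   = and (rename v w φ) (rename v w ψ)
rename v w (or φ ψ)    = or (rename v w φ) (rename v w ψ)
rename v w (exQ y D φ) = exQ (renameVar v w y) (renameSet v w D) (rename v w φ)
rename v w (allQ x φ)  = allQ (renameVar v w x) (rename v w φ)

Compatible : DQBF n → DQBF n → Set
Compatible φ ψ = ∀ v → v ∈ (qVars φ ∪ fsVars φ ∪ depVars φ) → v ∉ qVars ψ

data 𝒟 {n : ℕ} : DQBF n → Set where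
  d-cst  : ∀ b → 𝒟 (cst b)
  d-pos  : ∀ v → 𝒟 (pos v)
  d-neg  : ∀ v → 𝒟 (neg v)
  d-and  : ∀ {φ ψ} → 𝒟 φ → 𝒟 ψ → Compatible φ ψ → Compatible ψ φ → 𝒟 (and φ ψ)
  d-or   : ∀ {φ ψ} → 𝒟 φ → 𝒟 ψ → Compatible φ ψ → Compatible ψ φ → 𝒟 (or φ ψ)
  d-ex   : ∀ {φ v D} → 𝒟 φ → v ∉ qVars φ →
           (∀ u → u ∈ D → u ∉ qVars φ × u ≢ v) → 𝒟 (Ex v D φ)
  d-all  : ∀ {φ v} → 𝒟 φ → v ∉ qVars φ → 𝒟 (All v φ)

Assignment : ℕ → Set
Assignment n = Fin n → Bool

BFun : ℕ → Set
BFun n = Assignment n → Bool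

DependsOnly : BFun n → Subset n → Set
DependsOnly {n} f P = ∀ (a b : Assignment n) → (∀ u → u ∈ P → a u ≡ b u) → f a ≡ f b

SkolemCand : DQBF n → (Fin n → BFun n) → Set
SkolemCand ψ s =
  (∀ y D → BindsEx ψ y D → DependsOnly (s y) (D ∩ allVars ψ)) ×
  (∀ v → v ∉ exVars ψ → DependsOnly (s v) ∅)

evalF : (Fin n → Bool) → DQBF n → Bool
evalF val (cst b)     = b
evalF val (pos v)     = val v
evalF val (neg v)     = not (val v)
evalF val (and φ ψ)   = evalF val φ ∧ evalF val ψ
evalF val (or φ ψ)    = evalF val φ ∨ evalF val ψ
evalF val (exQ _ _ φ) = evalF val φ
evalF val (allQ _ φ)  = evalF val φ

evalS : DQBF n → (Fin n → BFun n) → Assignment n → Bool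
evalS ψ s a = evalF (λ v → if lookup (allVars ψ) v then a v else s v a) ψ

Sem : DQBF n → (Fin n → BFun n) → Set
Sem ψ s = SkolemCand ψ s × (∀ a → evalS ψ s a ≡ true)

Satisfiable : DQBF n → Set
Satisfiable {n} ψ = Σ (Fin n → BFun n) (Sem ψ)

_≃_ : DQBF n → DQBF n → Set
ψ₁ ≃ ψ₂ = ∀ s → Sem ψ₁ s ⇔ Sem ψ₂ s

_≈_ : DQBF n → DQBF n → Set
ψ₁ ≈ ψ₂ = Satisfiable ψ₁ ⇔ Satisfiable ψ₂

infix 4 _≃_ _≈_

-- Whether s is a Skolem function of ψ depends on ψ only through V^∀_ψ, V^∃_ψ, the sets
-- D_y ∩ V^∀_ψ and the truth table of the matrix.  For the equivalences these data agree on
-- both sides: the position of a universal quantifier is irrelevant, and a variable removed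
-- from a dependency set is never universal.  For the equisatisfiabilities Skolem functions are
-- transformed explicitly: a universal variable that has been dropped is fixed to 0 in the
-- functions that may no longer see it (b, f), and the fresh copy x' in (e) takes the value
-- of x.  In (h), if the first disjunct of the right-hand side fails at some assignment b₀
-- then, the universal variables of the two disjuncts being disjoint, the second one holds
-- everywhere and the Skolem function of y' can be used for y; whether such b₀ exists is
-- decidable since there are finitely many assignments.  Over a quantifier-free matrix all
-- Skolem functions are constants, so (c) and (d) amount to evaluating φ at both values of
-- the quantified variable.

module Submission where

open import Defs
open import Data.Nat using (ℕ)
open import Data.Fin using (Fin)
open import Data.Fin.Properties using (_≟_)
open import Data.Fin.Subset
  using (Subset; _∈_; _∉_; _⊆_; _∪_; _∩_; _─_; _-_; ⁅_⁆; Empty) renaming (⊥ to ∅)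
open import Data.Fin.Subset.Properties
  using (_∈?_; ∉⊥; x∈⁅x⁆; x∈⁅y⁆⇒x≡y; x∈p∪q⁺; x∈p∪q⁻; x∈p∩q⁺; x∈p∩q⁻;
         x∉⁅y⁆⇒x≢y; x∈p∧x≢y⇒x∈p-y; p─q⊆p; p─x─y≡p─y─x; ∪-assoc; ∪-comm; ⊆-min; ⊆-antisym;
         anySubset?)
open import Data.Bool using (Bool; true; false; not; _∧_; _∨_; if_then_else_)
open import Data.Bool.Properties using (∨-zeroʳ; ¬-not) renaming (_≟_ to _≟ᵇ_)
open import Data.Vec using (lookup; tabulate; _∷_; here; there)
open import Data.Vec.Properties using ([]=⇒lookup; lookup⇒[]=; lookup∘tabulate)
open import Data.Product using (∃-syntax; _×_; _,_; proj₁; proj₂)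
open import Data.Sum using (_⊎_; inj₁; inj₂; [_,_])
import Data.Sum as Sum
open import Data.Empty using (⊥)
open import Function using (_∘′_; id; case_of_)
open import Function.Bundles using (_⇔_; mk⇔; Equivalence)
open import Relation.Nullary using (Dec; does; yes; no; contradiction)
open import Relation.Binary.PropositionalEquality
  using (_≡_; _≢_; refl; sym; trans; cong; cong₂; subst; module ≡-Reasoning)

private
  variable
    n : ℕ
    u v x y : Fin n
    p q r : Subset n

x∈p─q⇒x∉q : (p q : Subset n) → x ∈ p ─ q → x ∉ q
x∈p─q⇒x∉q (_ ∷ p) (false ∷ q) here      ()
x∈p─q⇒x∉q (_ ∷ p) (_ ∷ q)     (there h) (there h') = x∈p─q⇒x∉q p q h h'

x∈p-y⇒x∈p : x ∈ p - y → x ∈ p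
x∈p-y⇒x∈p {p = p} {y = y} = p─q⊆p p ⁅ y ⁆

x∈p-y⇒x≢y : x ∈ p - y → x ≢ y
x∈p-y⇒x≢y {p = p} {y = y} h refl = x∈p─q⇒x∉q p ⁅ y ⁆ h (x∈⁅x⁆ y)

x∉p⇒lookup≡false : x ∉ p → lookup p x ≡ false
x∉p⇒lookup≡false {x = x} {p = p} x∉p with lookup p x in eq
... | true  = contradiction (lookup⇒[]= x p eq) x∉p
... | false = refl

∉-∪ : x ∉ p → x ∉ q → x ∉ p ∪ q
∉-∪ {p = p} {q = q} x∉p x∉q h = [ x∉p , x∉q ] (x∈p∪q⁻ p q h)

∉-∪⁻ : x ∉ p ∪ q → x ∉ p × x ∉ q
∉-∪⁻ x∉p∪q = x∉p∪q ∘′ x∈p∪q⁺ ∘′ inj₁ , x∉p∪q ∘′ x∈p∪q⁺ ∘′ inj₂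

Empty⇒∉ : Empty p → x ∉ p
Empty⇒∉ e h = e (_ , h)

Empty-∪ : Empty p → Empty q → Empty (p ∪ q)
Empty-∪ e e' (_ , h) = ∉-∪ (Empty⇒∉ e) (Empty⇒∉ e') h

∪-mono : ∀ {p' q' : Subset n} → p ⊆ p' → q ⊆ q' → p ∪ q ⊆ p' ∪ q'
∪-mono {p = p} {q = q} p⊆p' q⊆q' h =
  x∈p∪q⁺ ([ inj₁ ∘′ p⊆p' , inj₂ ∘′ q⊆q' ] (x∈p∪q⁻ p q h))

∪-swapʳ : (p q r : Subset n) → (p ∪ q) ∪ r ≡ (p ∪ r) ∪ q
∪-swapʳ p q r = trans (∪-assoc p q r) (trans (cong (p ∪_) (∪-comm q r)) (sym (∪-assoc p r q)))

∩-mono : ∀ {p' q' : Subset n} → p ⊆ p' → q ⊆ q' → p ∩ q ⊆ p' ∩ q'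
∩-mono {p = p} {q = q} p⊆p' q⊆q' h = let (h₁ , h₂) = x∈p∩q⁻ p q h in x∈p∩q⁺ (p⊆p' h₁ , q⊆q' h₂)

∩-monoˡ : p ⊆ q → p ∩ r ⊆ q ∩ r
∩-monoˡ p⊆q = ∩-mono p⊆q id

∩-reflexiveʳ : q ≡ r → p ∩ q ⊆ p ∩ r
∩-reflexiveʳ refl h = h

∩-⊆-minus : y ∉ r → p ∩ r ⊆ (p - y) ∩ r
∩-⊆-minus {r = r} {p = p} y∉r h =
  let (h₁ , h₂) = x∈p∩q⁻ p r h in x∈p∩q⁺ (x∈p∧x≢y⇒x∈p-y h₁ (λ { refl → y∉r h₂ }) , h₂)

∧-≡true : ∀ {p q} → p ∧ q ≡ true → p ≡ true × q ≡ true
∧-≡true {true}  {true}  _  = refl , refl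
∧-≡true {true}  {false} ()
∧-≡true {false}         ()

∧-≡true⁺ : ∀ {p q} → p ≡ true → q ≡ true → p ∧ q ≡ true
∧-≡true⁺ refl refl = refl

∧-select : ∀ (f : Bool → Bool) b → f false ∧ f true ≡ true → f b ≡ true
∧-select f false = proj₁ ∘′ ∧-≡true
∧-select f true  = proj₂ ∘′ ∧-≡true

∨-≡trueˡ : ∀ {p q} → p ≡ true → p ∨ q ≡ true
∨-≡trueˡ refl = refl

∨-≡trueʳ : ∀ {p q} → q ≡ true → p ∨ q ≡ true
∨-≡trueʳ {p} refl = ∨-zeroʳ p

∨-≡true-resolve : ∀ {p q} → p ≡ false → p ∨ q ≡ true → q ≡ true
∨-≡true-resolve refl h = h

∨-intro : ∀ (f : Bool → Bool) b → f b ≡ true → f false ∨ f true ≡ true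
∨-intro f false eq rewrite eq = refl
∨-intro f true  eq rewrite eq = ∨-zeroʳ (f false)

∨-witness : ∀ (f : Bool → Bool) → f false ∨ f true ≡ true → ∃[ b ] f b ≡ true
∨-witness f h with f false in eq
... | true  = false , eq
... | false = true , h

Agree : Subset n → Assignment n → Assignment n → Set
Agree P a b = ∀ u → u ∈ P → a u ≡ b u

DependsOnly-mono : ∀ {f : BFun n} → p ⊆ q → DependsOnly f p → DependsOnly f q
DependsOnly-mono p⊆q d a b a≈b = d a b (λ u → a≈b u ∘′ p⊆q)

DependsOnly-≗ : ∀ {f g : BFun n} → (∀ a → f a ≡ g a) → DependsOnly g p → DependsOnly f p
DependsOnly-≗ f≗g d a b a≈b = trans (f≗g a) (trans (d a b a≈b) (sym (f≗g b)))

DependsOnly-∘ : ∀ {f : BFun n} {θ : Assignment n → Assignment n} → DependsOnly f q →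
                (∀ a a' → Agree p a a' → Agree q (θ a) (θ a')) → DependsOnly (f ∘′ θ) p
DependsOnly-∘ d θ-agree a a' a≈a' = d _ _ (θ-agree a a' a≈a')

constant : ∀ {f : BFun n} → DependsOnly f ∅ → ∀ a b → f a ≡ f b
constant d a b = d a b (λ _ h → contradiction h ∉⊥)

constant-∘ : ∀ {f : BFun n} {θ : Assignment n → Assignment n} →
             DependsOnly f ∅ → DependsOnly (f ∘′ θ) ∅
constant-∘ d a b _ = constant d _ _

_[_≔_] : ∀ {A : Set} → (Fin n → A) → Fin n → A → Fin n → A
(f [ x ≔ b ]) u = if does (u ≟ x) then b else f u

update-≡ : ∀ {A : Set} (f : Fin n → A) x b → (f [ x ≔ b ]) x ≡ b
update-≡ f x b with x ≟ x
... | yes _   = refl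
... | no x≢x  = contradiction refl x≢x

update-≢ : ∀ {A : Set} (f : Fin n → A) {x} b → u ≢ x → (f [ x ≔ b ]) u ≡ f u
update-≢ {u = u} f {x} b u≢x with u ≟ x
... | yes u≡x = contradiction u≡x u≢x
... | no _    = refl

update-cong : ∀ {A : Set} (f g : Fin n → A) x b → (∀ u → u ≢ x → f u ≡ g u) →
              (f [ x ≔ b ]) v ≡ (g [ x ≔ b ]) v
update-cong {v = v} f g x b f≗g with v ≟ x
... | yes _   = refl
... | no v≢x  = f≗g v v≢x

Agree-update : ∀ {a a' : Assignment n} {b b'} → (∀ {u} → u ∈ p → u ≢ x → u ∈ q) →
               Agree q a a' → (x ∈ p → b ≡ b') → Agree p (a [ x ≔ b ]) (a' [ x ≔ b' ])
Agree-update {x = x} p⊆q a≈a' x∈p⇒b≡b' u u∈p with u ≟ x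
... | yes refl = x∈p⇒b≡b' u∈p
... | no u≢x   = a≈a' u (p⊆q u∈p u≢x)

-- evalS ψ s a  is  evalF (extend (allVars ψ) s a) ψ  by definition.
extend : Subset n → (Fin n → BFun n) → Assignment n → Assignment n
extend A s a v = if lookup A v then a v else s v a

extend-∈ : ∀ A (s : Fin n → BFun n) a → v ∈ A → extend A s a v ≡ a v
extend-∈ {v = v} A s a v∈A rewrite []=⇒lookup v∈A = refl

extend-∉ : ∀ A (s : Fin n → BFun n) a → v ∉ A → extend A s a v ≡ s v a
extend-∉ A s a v∉A rewrite x∉p⇒lookup≡false v∉A = refl

extend-≡ : ∀ {A A' : Subset n} s a s' a' → (v ∈ A → v ∈ A') → (v ∈ A' → v ∈ A) →
           (v ∈ A → a v ≡ a' v) → (v ∉ A → s v a ≡ s' v a') →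
           extend A s a v ≡ extend A' s' a' v
extend-≡ {v = v} {A} {A'} s a s' a' to from on-A off-A with v ∈? A
... | yes v∈A = trans (extend-∈ A s a v∈A) (trans (on-A v∈A) (sym (extend-∈ A' s' a' (to v∈A))))
... | no  v∉A = trans (extend-∉ A s a v∉A)
                  (trans (off-A v∉A) (sym (extend-∉ A' s' a' (v∉A ∘′ from))))

∀-assignment? : ∀ (P : Assignment n → Bool) → (∀ a b → (∀ u → a u ≡ b u) → P a ≡ P b) →
                (∀ a → P a ≡ true) ⊎ ∃[ a ] P a ≡ false
∀-assignment? P P-ext with anySubset? (λ p → P (lookup p) ≟ᵇ false)
... | yes (p , Pp≡false) = inj₂ (lookup p , Pp≡false)
... | no ∄counterexample = inj₁ λ a →
  trans (P-ext a (lookup (tabulate a)) (λ u → sym (lookup∘tabulate a u)))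
        (¬-not (λ Pa≡false → ∄counterexample (tabulate a , Pa≡false)))

removeDep-exVars : ∀ x (φ : DQBF n) → exVars (removeDep x φ) ≡ exVars φ
removeDep-exVars x (cst _)     = refl
removeDep-exVars x (pos _)     = refl
removeDep-exVars x (neg _)     = refl
removeDep-exVars x (and φ ψ)   = cong₂ _∪_ (removeDep-exVars x φ) (removeDep-exVars x ψ)
removeDep-exVars x (or φ ψ)    = cong₂ _∪_ (removeDep-exVars x φ) (removeDep-exVars x ψ)
removeDep-exVars x (exQ y _ φ) = cong (_∪ ⁅ y ⁆) (removeDep-exVars x φ)
removeDep-exVars x (allQ _ φ)  = removeDep-exVars x φ

removeDep-allVars : ∀ x (φ : DQBF n) → allVars (removeDep x φ) ≡ allVars φ
removeDep-allVars x (cst _)     = refl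
removeDep-allVars x (pos _)     = refl
removeDep-allVars x (neg _)     = refl
removeDep-allVars x (and φ ψ)   = cong₂ _∪_ (removeDep-allVars x φ) (removeDep-allVars x ψ)
removeDep-allVars x (or φ ψ)    = cong₂ _∪_ (removeDep-allVars x φ) (removeDep-allVars x ψ)
removeDep-allVars x (exQ _ _ φ) = removeDep-allVars x φ
removeDep-allVars x (allQ y φ)  = cong (_∪ ⁅ y ⁆) (removeDep-allVars x φ)

removeDep-fsVars : ∀ x (φ : DQBF n) → fsVars (removeDep x φ) ≡ fsVars φ
removeDep-fsVars x (cst _)     = refl
removeDep-fsVars x (pos _)     = refl
removeDep-fsVars x (neg _)     = refl
removeDep-fsVars x (and φ ψ)   = cong₂ _∪_ (removeDep-fsVars x φ) (removeDep-fsVars x ψ)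
removeDep-fsVars x (or φ ψ)    = cong₂ _∪_ (removeDep-fsVars x φ) (removeDep-fsVars x ψ)
removeDep-fsVars x (exQ y _ φ) = cong (_- y) (removeDep-fsVars x φ)
removeDep-fsVars x (allQ y φ)  = cong (_- y) (removeDep-fsVars x φ)

removeDep-qVars : ∀ x (φ : DQBF n) → qVars (removeDep x φ) ≡ qVars φ
removeDep-qVars x φ = cong₂ _∪_ (removeDep-exVars x φ) (removeDep-allVars x φ)

removeDep-occVars : ∀ x (φ : DQBF n) → occVars (removeDep x φ) ≡ occVars φ
removeDep-occVars x φ = cong₂ _∪_ (removeDep-qVars x φ) (removeDep-fsVars x φ)

removeDep-depVars : ∀ x (φ : DQBF n) → depVars (removeDep x φ) ⊆ depVars φ
removeDep-depVars x (cst _)     = id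
removeDep-depVars x (pos _)     = id
removeDep-depVars x (neg _)     = id
removeDep-depVars x (and φ ψ)   = ∪-mono (removeDep-depVars x φ) (removeDep-depVars x ψ)
removeDep-depVars x (or φ ψ)    = ∪-mono (removeDep-depVars x φ) (removeDep-depVars x ψ)
removeDep-depVars x (exQ _ D φ) = ∪-mono (x∈p-y⇒x∈p {p = D}) (removeDep-depVars x φ)
removeDep-depVars x (allQ _ φ)  = removeDep-depVars x φ

evalF-removeDep : ∀ x (φ : DQBF n) val → evalF val (removeDep x φ) ≡ evalF val φ
evalF-removeDep x (cst _)     val = refl
evalF-removeDep x (pos _)     val = refl
evalF-removeDep x (neg _)     val = refl
evalF-removeDep x (and φ ψ)   val = cong₂ _∧_ (evalF-removeDep x φ val) (evalF-removeDep x ψ val)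
evalF-removeDep x (or φ ψ)    val = cong₂ _∨_ (evalF-removeDep x φ val) (evalF-removeDep x ψ val)
evalF-removeDep x (exQ _ _ φ) val = evalF-removeDep x φ val
evalF-removeDep x (allQ _ φ)  val = evalF-removeDep x φ val

removeDep-comm : ∀ x y (φ : DQBF n) → removeDep x (removeDep y φ) ≡ removeDep y (removeDep x φ)
removeDep-comm x y (cst _)     = refl
removeDep-comm x y (pos _)     = refl
removeDep-comm x y (neg _)     = refl
removeDep-comm x y (and φ ψ)   = cong₂ and (removeDep-comm x y φ) (removeDep-comm x y ψ)
removeDep-comm x y (or φ ψ)    = cong₂ or (removeDep-comm x y φ) (removeDep-comm x y ψ)
removeDep-comm x y (exQ v D φ) = cong₂ (exQ v) (p─x─y≡p─y─x D y x) (removeDep-comm x y φ)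
removeDep-comm x y (allQ v φ)  = cong (allQ v) (removeDep-comm x y φ)

BindsEx-removeDep⁺ : ∀ x (φ : DQBF n) {D} → BindsEx φ y D → BindsEx (removeDep x φ) y (D - x)
BindsEx-removeDep⁺ x (and φ ψ)   (inj₁ b)             = inj₁ (BindsEx-removeDep⁺ x φ b)
BindsEx-removeDep⁺ x (and φ ψ)   (inj₂ b)             = inj₂ (BindsEx-removeDep⁺ x ψ b)
BindsEx-removeDep⁺ x (or φ ψ)    (inj₁ b)             = inj₁ (BindsEx-removeDep⁺ x φ b)
BindsEx-removeDep⁺ x (or φ ψ)    (inj₂ b)             = inj₂ (BindsEx-removeDep⁺ x ψ b)
BindsEx-removeDep⁺ x (exQ _ _ φ) (inj₁ (refl , refl)) = inj₁ (refl , refl)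
BindsEx-removeDep⁺ x (exQ _ _ φ) (inj₂ b)             = inj₂ (BindsEx-removeDep⁺ x φ b)
BindsEx-removeDep⁺ x (allQ _ φ)  b                    = BindsEx-removeDep⁺ x φ b

BindsEx-removeDep⁻ : ∀ x (φ : DQBF n) {E} → BindsEx (removeDep x φ) y E →
                     ∃[ D ] BindsEx φ y D × E ≡ D - x
BindsEx-removeDep⁻ x (and φ ψ) (inj₁ b) =
  let (D , b' , eq) = BindsEx-removeDep⁻ x φ b in D , inj₁ b' , eq
BindsEx-removeDep⁻ x (and φ ψ) (inj₂ b) =
  let (D , b' , eq) = BindsEx-removeDep⁻ x ψ b in D , inj₂ b' , eq
BindsEx-removeDep⁻ x (or φ ψ) (inj₁ b) =
  let (D , b' , eq) = BindsEx-removeDep⁻ x φ b in D , inj₁ b' , eq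
BindsEx-removeDep⁻ x (or φ ψ) (inj₂ b) =
  let (D , b' , eq) = BindsEx-removeDep⁻ x ψ b in D , inj₂ b' , eq
BindsEx-removeDep⁻ x (exQ _ D φ) (inj₁ (refl , refl)) = D , inj₁ (refl , refl) , refl
BindsEx-removeDep⁻ x (exQ _ _ φ) (inj₂ b) =
  let (D , b' , eq) = BindsEx-removeDep⁻ x φ b in D , inj₂ b' , eq
BindsEx-removeDep⁻ x (allQ _ φ) b = BindsEx-removeDep⁻ x φ b

Occurs : Fin n → DQBF n → Set
Occurs v (cst _)     = ⊥
Occurs v (pos u)     = v ≡ u
Occurs v (neg u)     = v ≡ u
Occurs v (and φ ψ)   = Occurs v φ ⊎ Occurs v ψ
Occurs v (or φ ψ)    = Occurs v φ ⊎ Occurs v ψ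
Occurs v (exQ _ _ φ) = Occurs v φ
Occurs v (allQ _ φ)  = Occurs v φ

evalF-cong : ∀ (φ : DQBF n) {val val'} → (∀ v → Occurs v φ → val v ≡ val' v) →
             evalF val φ ≡ evalF val' φ
evalF-cong (cst _)     eq = refl
evalF-cong (pos u)     eq = eq u refl
evalF-cong (neg u)     eq = cong not (eq u refl)
evalF-cong (and φ ψ)   eq =
  cong₂ _∧_ (evalF-cong φ (λ v → eq v ∘′ inj₁)) (evalF-cong ψ (λ v → eq v ∘′ inj₂))
evalF-cong (or φ ψ)    eq =
  cong₂ _∨_ (evalF-cong φ (λ v → eq v ∘′ inj₁)) (evalF-cong ψ (λ v → eq v ∘′ inj₂))
evalF-cong (exQ _ _ φ) eq = evalF-cong φ eq
evalF-cong (allQ _ φ)  eq = evalF-cong φ eq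

exVars⊆qVars : ∀ (φ : DQBF n) → exVars φ ⊆ qVars φ
exVars⊆qVars φ = x∈p∪q⁺ ∘′ inj₁

allVars⊆qVars : ∀ (φ : DQBF n) → allVars φ ⊆ qVars φ
allVars⊆qVars φ = x∈p∪q⁺ ∘′ inj₂

Occurs⇒∈occVars : ∀ (φ : DQBF n) → Occurs v φ → v ∈ occVars φ
Occurs⇒∈occVars φ o = x∈p∪q⁺ (quantified-or-free φ o)
  where
  binder : ∀ {v y : Fin n} {F} → v ∈ F → v ∈ ⁅ y ⁆ ⊎ v ∈ F - y
  binder {v = v} {y} v∈F with v ≟ y
  ... | yes refl = inj₁ (x∈⁅x⁆ v)
  ... | no v≢y   = inj₂ (x∈p∧x≢y⇒x∈p-y v∈F v≢y)

  quantified-or-free : ∀ {v} (φ : DQBF n) → Occurs v φ → v ∈ qVars φ ⊎ v ∈ fsVars φ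
  quantified-or-free (pos u) refl = inj₂ (x∈⁅x⁆ u)
  quantified-or-free (neg u) refl = inj₂ (x∈⁅x⁆ u)
  quantified-or-free (and φ ψ) (inj₁ o) =
    Sum.map (∪-mono (x∈p∪q⁺ ∘′ inj₁) (x∈p∪q⁺ ∘′ inj₁)) (x∈p∪q⁺ ∘′ inj₁) (quantified-or-free φ o)
  quantified-or-free (and φ ψ) (inj₂ o) =
    Sum.map (∪-mono (x∈p∪q⁺ ∘′ inj₂) (x∈p∪q⁺ ∘′ inj₂)) (x∈p∪q⁺ ∘′ inj₂) (quantified-or-free ψ o)
  quantified-or-free (or φ ψ) (inj₁ o) =
    Sum.map (∪-mono (x∈p∪q⁺ ∘′ inj₁) (x∈p∪q⁺ ∘′ inj₁)) (x∈p∪q⁺ ∘′ inj₁) (quantified-or-free φ o)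
  quantified-or-free (or φ ψ) (inj₂ o) =
    Sum.map (∪-mono (x∈p∪q⁺ ∘′ inj₂) (x∈p∪q⁺ ∘′ inj₂)) (x∈p∪q⁺ ∘′ inj₂) (quantified-or-free ψ o)
  quantified-or-free (exQ y _ φ) o with quantified-or-free φ o
  ... | inj₁ q = inj₁ (∪-mono (x∈p∪q⁺ ∘′ inj₁) id q)
  ... | inj₂ f = Sum.map₁ (x∈p∪q⁺ ∘′ inj₁ ∘′ x∈p∪q⁺ ∘′ inj₂) (binder f)
  quantified-or-free (allQ y φ) o with quantified-or-free φ o
  ... | inj₁ q = inj₁ (∪-mono id (x∈p∪q⁺ ∘′ inj₁) q)
  ... | inj₂ f = Sum.map₁ (x∈p∪q⁺ ∘′ inj₂ ∘′ x∈p∪q⁺ ∘′ inj₂) (binder f)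

Occurs-∉occVars : ∀ (φ : DQBF n) → v ∉ occVars φ → Occurs u φ → u ≢ v
Occurs-∉occVars φ v∉φ o refl = v∉φ (Occurs⇒∈occVars φ o)

Compatible-qVars : ∀ (φ ψ : DQBF n) → Compatible φ ψ → v ∈ qVars φ → v ∉ qVars ψ
Compatible-qVars φ ψ c h = c _ (x∈p∪q⁺ (inj₁ h))

Compatible-depVars : ∀ (φ ψ : DQBF n) → Compatible φ ψ → v ∈ depVars φ → v ∉ qVars ψ
Compatible-depVars φ ψ c h = c _ (x∈p∪q⁺ (inj₂ (x∈p∪q⁺ (inj₂ h))))

Compatible-occVars : ∀ (φ ψ : DQBF n) → Compatible φ ψ → v ∈ occVars φ → v ∉ qVars ψ
Compatible-occVars φ ψ c h with x∈p∪q⁻ (qVars φ) (fsVars φ) h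
... | inj₁ q = Compatible-qVars φ ψ c q
... | inj₂ f = c _ (x∈p∪q⁺ (inj₂ (x∈p∪q⁺ (inj₁ f))))

Compatible-Occurs : ∀ (φ ψ : DQBF n) → Compatible φ ψ → Occurs v φ → v ∉ qVars ψ
Compatible-Occurs φ ψ c = Compatible-occVars φ ψ c ∘′ Occurs⇒∈occVars φ

Compatible-removeDep : ∀ x (φ ψ : DQBF n) → Compatible φ ψ →
                       Compatible (removeDep x φ) (removeDep x ψ)
Compatible-removeDep x φ ψ c v h
  rewrite removeDep-qVars x ψ | removeDep-qVars x φ | removeDep-fsVars x φ =
  c v (∪-mono id (∪-mono id (removeDep-depVars x φ)) h)

𝒟-removeDep : ∀ x {φ : DQBF n} → 𝒟 φ → 𝒟 (removeDep x φ)
𝒟-removeDep x (d-cst b) = d-cst b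
𝒟-removeDep x (d-pos v) = d-pos v
𝒟-removeDep x (d-neg v) = d-neg v
𝒟-removeDep x (d-and {φ} {ψ} d₁ d₂ c₁₂ c₂₁) =
  d-and (𝒟-removeDep x d₁) (𝒟-removeDep x d₂)
        (Compatible-removeDep x φ ψ c₁₂) (Compatible-removeDep x ψ φ c₂₁)
𝒟-removeDep x (d-or {φ} {ψ} d₁ d₂ c₁₂ c₂₁) =
  d-or (𝒟-removeDep x d₁) (𝒟-removeDep x d₂)
       (Compatible-removeDep x φ ψ c₁₂) (Compatible-removeDep x ψ φ c₂₁)
𝒟-removeDep x (d-ex {φ} {v} {D} d v∉φ D-fresh) =
  subst 𝒟 (cong (exQ v (D - x)) (removeDep-comm v x φ))
    (d-ex (𝒟-removeDep x d) (v∉φ ∘′ fromQ)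
          (λ u h → let (u∉φ , u≢v) = D-fresh u (x∈p-y⇒x∈p h) in u∉φ ∘′ fromQ , u≢v))
  where
  fromQ : ∀ {u} → u ∈ qVars (removeDep x φ) → u ∈ qVars φ
  fromQ = subst (_ ∈_) (removeDep-qVars x φ)
𝒟-removeDep x (d-all {φ} d v∉φ) =
  d-all (𝒟-removeDep x d) (v∉φ ∘′ subst (_ ∈_) (removeDep-qVars x φ))

-- Stated for exQ: the index removeDep v φ of d-ex unifies with a variable ψ but not with
-- a given removeDep y φ.
𝒟-exQ⁻ : ∀ {D} {ψ : DQBF n} → 𝒟 (exQ y D ψ) →
         𝒟 ψ × y ∉ qVars ψ × (∀ u → u ∈ D → u ∉ qVars ψ)
𝒟-exQ⁻ (d-ex {φ} {v} d v∉φ D-fresh) =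
  𝒟-removeDep v d , v∉φ ∘′ fromQ , λ u h → proj₁ (D-fresh u h) ∘′ fromQ
  where
  fromQ : ∀ {u} → u ∈ qVars (removeDep v φ) → u ∈ qVars φ
  fromQ = subst (_ ∈_) (removeDep-qVars v φ)

𝒟-Ex⁻ : ∀ {D} {φ : DQBF n} → 𝒟 (Ex y D φ) → y ∉ qVars φ × (∀ u → u ∈ D → u ∉ allVars φ)
𝒟-Ex⁻ {y = y} {φ = φ} d =
  let (_ , y∉φ , D-fresh) = 𝒟-exQ⁻ d in
  y∉φ ∘′ fromQ , λ u u∈D → D-fresh u u∈D ∘′ fromQ ∘′ allVars⊆qVars φ
  where
  fromQ : ∀ {u} → u ∈ qVars φ → u ∈ qVars (removeDep y φ)
  fromQ = subst (_ ∈_) (sym (removeDep-qVars y φ))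

𝒟-Ex-Ex⁻ : ∀ {y₂ D₁ D₂} {φ : DQBF n} → 𝒟 (Ex y D₁ (Ex y₂ D₂ φ)) → y ∉ allVars φ
𝒟-Ex-Ex⁻ {y₂ = y₂} {D₂ = D₂} {φ = φ} d =
  proj₁ (𝒟-Ex⁻ d) ∘′ allVars⊆qVars (Ex y₂ D₂ φ) ∘′ subst (_ ∈_) (sym (removeDep-allVars y₂ φ))

𝒟-or-Ex⇒≢ : ∀ {y'} {D D'} {φ φ' : DQBF n} → 𝒟 (or (Ex y D φ) (Ex y' D' φ')) → y ≢ y'
𝒟-or-Ex⇒≢ {y = y} {D = D} {D'} {φ} {φ'} (d-or _ _ c _) refl =
  Compatible-qVars (Ex y D φ) (Ex y D' φ') c (bound-y D φ) (bound-y D' φ')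
  where
  bound-y : ∀ D φ → y ∈ qVars (Ex y D φ)
  bound-y D φ = x∈p∪q⁺ (inj₁ (x∈p∪q⁺ (inj₂ (x∈⁅x⁆ y))))

BindsEx⇒∈exVars : ∀ (φ : DQBF n) {D} → BindsEx φ y D → y ∈ exVars φ
BindsEx⇒∈exVars (and φ ψ)   (inj₁ b)             = x∈p∪q⁺ (inj₁ (BindsEx⇒∈exVars φ b))
BindsEx⇒∈exVars (and φ ψ)   (inj₂ b)             = x∈p∪q⁺ (inj₂ (BindsEx⇒∈exVars ψ b))
BindsEx⇒∈exVars (or φ ψ)    (inj₁ b)             = x∈p∪q⁺ (inj₁ (BindsEx⇒∈exVars φ b))
BindsEx⇒∈exVars (or φ ψ)    (inj₂ b)             = x∈p∪q⁺ (inj₂ (BindsEx⇒∈exVars ψ b))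
BindsEx⇒∈exVars (exQ v _ φ) (inj₁ (refl , _))    = x∈p∪q⁺ (inj₂ (x∈⁅x⁆ v))
BindsEx⇒∈exVars (exQ _ _ φ) (inj₂ b)             = x∈p∪q⁺ (inj₁ (BindsEx⇒∈exVars φ b))
BindsEx⇒∈exVars (allQ _ φ)  b                    = BindsEx⇒∈exVars φ b

BindsEx⇒⊆depVars : ∀ (φ : DQBF n) {D} → BindsEx φ y D → D ⊆ depVars φ
BindsEx⇒⊆depVars (and φ ψ)   (inj₁ b)             = x∈p∪q⁺ ∘′ inj₁ ∘′ BindsEx⇒⊆depVars φ b
BindsEx⇒⊆depVars (and φ ψ)   (inj₂ b)             = x∈p∪q⁺ ∘′ inj₂ ∘′ BindsEx⇒⊆depVars ψ b
BindsEx⇒⊆depVars (or φ ψ)    (inj₁ b)             = x∈p∪q⁺ ∘′ inj₁ ∘′ BindsEx⇒⊆depVars φ b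
BindsEx⇒⊆depVars (or φ ψ)    (inj₂ b)             = x∈p∪q⁺ ∘′ inj₂ ∘′ BindsEx⇒⊆depVars ψ b
BindsEx⇒⊆depVars (exQ _ _ φ) (inj₁ (refl , refl)) = x∈p∪q⁺ ∘′ inj₁
BindsEx⇒⊆depVars (exQ _ _ φ) (inj₂ b)             = x∈p∪q⁺ ∘′ inj₂ ∘′ BindsEx⇒⊆depVars φ b
BindsEx⇒⊆depVars (allQ _ φ)  b                    = BindsEx⇒⊆depVars φ b

∈exVars⇒BindsEx : ∀ (φ : DQBF n) → y ∈ exVars φ → ∃[ D ] BindsEx φ y D
∈exVars⇒BindsEx (cst _) h = contradiction h ∉⊥
∈exVars⇒BindsEx (pos _) h = contradiction h ∉⊥
∈exVars⇒BindsEx (neg _) h = contradiction h ∉⊥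
∈exVars⇒BindsEx (and φ ψ) h with x∈p∪q⁻ (exVars φ) (exVars ψ) h
... | inj₁ h' = let (D , b) = ∈exVars⇒BindsEx φ h' in D , inj₁ b
... | inj₂ h' = let (D , b) = ∈exVars⇒BindsEx ψ h' in D , inj₂ b
∈exVars⇒BindsEx (or φ ψ) h with x∈p∪q⁻ (exVars φ) (exVars ψ) h
... | inj₁ h' = let (D , b) = ∈exVars⇒BindsEx φ h' in D , inj₁ b
... | inj₂ h' = let (D , b) = ∈exVars⇒BindsEx ψ h' in D , inj₂ b
∈exVars⇒BindsEx (exQ y D φ) h with x∈p∪q⁻ (exVars φ) ⁅ y ⁆ h
... | inj₁ h' = let (D' , b) = ∈exVars⇒BindsEx φ h' in D' , inj₂ b
... | inj₂ h' = D , inj₁ (sym (x∈⁅y⁆⇒x≡y y h') , refl)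
∈exVars⇒BindsEx (allQ _ φ) h = ∈exVars⇒BindsEx φ h

substConst-allVars : ∀ v b (φ : DQBF n) → allVars (substConst v b φ) ≡ allVars φ
substConst-allVars v b (cst _) = refl
substConst-allVars v b (pos u) with does (u ≟ v)
... | true  = refl
... | false = refl
substConst-allVars v b (neg u) with does (u ≟ v)
... | true  = refl
... | false = refl
substConst-allVars v b (and φ ψ)   = cong₂ _∪_ (substConst-allVars v b φ) (substConst-allVars v b ψ)
substConst-allVars v b (or φ ψ)    = cong₂ _∪_ (substConst-allVars v b φ) (substConst-allVars v b ψ)
substConst-allVars v b (exQ _ _ φ) = substConst-allVars v b φ
substConst-allVars v b (allQ y φ)  = cong (_∪ ⁅ y ⁆) (substConst-allVars v b φ)

evalF-substConst : ∀ v b (φ : DQBF n) val → evalF val (substConst v b φ) ≡ evalF (val [ v ≔ b ]) φ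
evalF-substConst v b (cst _) val = refl
evalF-substConst v b (pos u) val with does (u ≟ v)
... | true  = refl
... | false = refl
evalF-substConst v b (neg u) val with does (u ≟ v)
... | true  = refl
... | false = refl
evalF-substConst v b (and φ ψ) val =
  cong₂ _∧_ (evalF-substConst v b φ val) (evalF-substConst v b ψ val)
evalF-substConst v b (or φ ψ) val =
  cong₂ _∨_ (evalF-substConst v b φ val) (evalF-substConst v b ψ val)
evalF-substConst v b (exQ _ _ φ) val = evalF-substConst v b φ val
evalF-substConst v b (allQ _ φ)  val = evalF-substConst v b φ val

renameVar-≡ : ∀ (x x' : Fin n) → renameVar x x' x ≡ x'
renameVar-≡ x x' with x ≟ x
... | yes _   = refl
... | no x≢x  = contradiction refl x≢x

renameVar-≢ : ∀ {x} x' → u ≢ x → renameVar x x' u ≡ u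
renameVar-≢ {u = u} {x} x' u≢x with u ≟ x
... | yes u≡x = contradiction u≡x u≢x
... | no _    = refl

∈renameSet⁺ : ∀ {x} x' D → u ∈ D → u ≢ x → u ∈ renameSet {n} x x' D
∈renameSet⁺ {u = u} {x} x' D u∈D u≢x with lookup D x
... | true  = x∈p∪q⁺ (inj₁ (x∈p∧x≢y⇒x∈p-y u∈D u≢x))
... | false = u∈D

x'∈renameSet : ∀ {x} x' D → x ∈ D → x' ∈ renameSet {n} x x' D
x'∈renameSet {x = x} x' D x∈D rewrite []=⇒lookup x∈D = x∈p∪q⁺ (inj₂ (x∈⁅x⁆ x'))

∈renameSet⁻ : ∀ {x} x' D → u ∈ renameSet {n} x x' D → (u ≡ x' × x ∈ D) ⊎ (u ∈ D × u ≢ x)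
∈renameSet⁻ {u = u} {x} x' D h with lookup D x in eq
... | false = inj₂ (h , λ { refl → true≢false (trans (sym ([]=⇒lookup h)) eq) })
  where
  true≢false : true ≢ false
  true≢false ()
... | true with x∈p∪q⁻ (D - x) ⁅ x' ⁆ h
...   | inj₁ h' = inj₂ (x∈p-y⇒x∈p h' , x∈p-y⇒x≢y h')
...   | inj₂ h' = inj₁ (x∈⁅y⁆⇒x≡y x' h' , lookup⇒[]= x D eq)

renameSet-minus : ∀ x x' (F : Subset n) → x' ∉ F → renameSet x x' F - x' ≡ F - x
renameSet-minus x x' F x'∉F = ⊆-antisym
  (λ h → case ∈renameSet⁻ x' F (x∈p-y⇒x∈p h) of λ
    { (inj₁ (u≡x' , _))  → contradiction u≡x' (x∈p-y⇒x≢y h)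
    ; (inj₂ (u∈F , u≢x)) → x∈p∧x≢y⇒x∈p-y u∈F u≢x })
  (λ h → let u∈F = x∈p-y⇒x∈p h in
    x∈p∧x≢y⇒x∈p-y (∈renameSet⁺ x' F u∈F (x∈p-y⇒x≢y h)) λ { refl → x'∉F u∈F })

rename-exVars : ∀ x x' (φ : DQBF n) → x ∉ exVars φ → exVars (rename x x' φ) ≡ exVars φ
rename-exVars x x' (cst _)   _ = refl
rename-exVars x x' (pos _)   _ = refl
rename-exVars x x' (neg _)   _ = refl
rename-exVars x x' (and φ ψ) x∉ =
  let (x∉φ , x∉ψ) = ∉-∪⁻ x∉ in cong₂ _∪_ (rename-exVars x x' φ x∉φ) (rename-exVars x x' ψ x∉ψ)
rename-exVars x x' (or φ ψ) x∉ =
  let (x∉φ , x∉ψ) = ∉-∪⁻ x∉ in cong₂ _∪_ (rename-exVars x x' φ x∉φ) (rename-exVars x x' ψ x∉ψ)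
rename-exVars x x' (exQ y _ φ) x∉ =
  let (x∉φ , x∉y) = ∉-∪⁻ x∉
  in cong₂ _∪_ (rename-exVars x x' φ x∉φ) (cong ⁅_⁆ (renameVar-≢ x' (x∉⁅y⁆⇒x≢y x∉y ∘′ sym)))
rename-exVars x x' (allQ _ φ) x∉ = rename-exVars x x' φ x∉

rename-allVars : ∀ x x' (φ : DQBF n) → x ∉ allVars φ → allVars (rename x x' φ) ≡ allVars φ
rename-allVars x x' (cst _)   _ = refl
rename-allVars x x' (pos _)   _ = refl
rename-allVars x x' (neg _)   _ = refl
rename-allVars x x' (and φ ψ) x∉ =
  let (x∉φ , x∉ψ) = ∉-∪⁻ x∉ in cong₂ _∪_ (rename-allVars x x' φ x∉φ) (rename-allVars x x' ψ x∉ψ)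
rename-allVars x x' (or φ ψ) x∉ =
  let (x∉φ , x∉ψ) = ∉-∪⁻ x∉ in cong₂ _∪_ (rename-allVars x x' φ x∉φ) (rename-allVars x x' ψ x∉ψ)
rename-allVars x x' (exQ _ _ φ) x∉ = rename-allVars x x' φ x∉
rename-allVars x x' (allQ y φ) x∉ =
  let (x∉φ , x∉y) = ∉-∪⁻ x∉
  in cong₂ _∪_ (rename-allVars x x' φ x∉φ) (cong ⁅_⁆ (renameVar-≢ x' (x∉⁅y⁆⇒x≢y x∉y ∘′ sym)))

evalF-rename : ∀ x x' (φ : DQBF n) val → evalF val (rename x x' φ) ≡ evalF (val ∘′ renameVar x x') φ
evalF-rename x x' (cst _)     val = refl
evalF-rename x x' (pos _)     val = refl
evalF-rename x x' (neg _)     val = refl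
evalF-rename x x' (and φ ψ)   val = cong₂ _∧_ (evalF-rename x x' φ val) (evalF-rename x x' ψ val)
evalF-rename x x' (or φ ψ)    val = cong₂ _∨_ (evalF-rename x x' φ val) (evalF-rename x x' ψ val)
evalF-rename x x' (exQ _ _ φ) val = evalF-rename x x' φ val
evalF-rename x x' (allQ _ φ)  val = evalF-rename x x' φ val

BindsEx-rename⁺ : ∀ x x' (φ : DQBF n) → x ∉ exVars φ → ∀ {D} → BindsEx φ y D →
                  BindsEx (rename x x' φ) y (renameSet x x' D)
BindsEx-rename⁺ x x' (and φ ψ) x∉ (inj₁ b) = inj₁ (BindsEx-rename⁺ x x' φ (proj₁ (∉-∪⁻ x∉)) b)
BindsEx-rename⁺ x x' (and φ ψ) x∉ (inj₂ b) = inj₂ (BindsEx-rename⁺ x x' ψ (proj₂ (∉-∪⁻ x∉)) b)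
BindsEx-rename⁺ x x' (or φ ψ)  x∉ (inj₁ b) = inj₁ (BindsEx-rename⁺ x x' φ (proj₁ (∉-∪⁻ x∉)) b)
BindsEx-rename⁺ x x' (or φ ψ)  x∉ (inj₂ b) = inj₂ (BindsEx-rename⁺ x x' ψ (proj₂ (∉-∪⁻ x∉)) b)
BindsEx-rename⁺ x x' (exQ y _ φ) x∉ (inj₁ (refl , refl)) =
  inj₁ (renameVar-≢ x' (x∉⁅y⁆⇒x≢y (proj₂ (∉-∪⁻ x∉)) ∘′ sym) , refl)
BindsEx-rename⁺ x x' (exQ _ _ φ) x∉ (inj₂ b) = inj₂ (BindsEx-rename⁺ x x' φ (proj₁ (∉-∪⁻ x∉)) b)
BindsEx-rename⁺ x x' (allQ _ φ)  x∉ b        = BindsEx-rename⁺ x x' φ x∉ b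

BindsEx-rename⁻ : ∀ x x' (φ : DQBF n) → x ∉ exVars φ → ∀ {E} → BindsEx (rename x x' φ) y E →
                  ∃[ D ] BindsEx φ y D × E ≡ renameSet x x' D
BindsEx-rename⁻ x x' (and φ ψ) x∉ (inj₁ b) =
  let (D , b' , eq) = BindsEx-rename⁻ x x' φ (proj₁ (∉-∪⁻ x∉)) b in D , inj₁ b' , eq
BindsEx-rename⁻ x x' (and φ ψ) x∉ (inj₂ b) =
  let (D , b' , eq) = BindsEx-rename⁻ x x' ψ (proj₂ (∉-∪⁻ x∉)) b in D , inj₂ b' , eq
BindsEx-rename⁻ x x' (or φ ψ) x∉ (inj₁ b) =
  let (D , b' , eq) = BindsEx-rename⁻ x x' φ (proj₁ (∉-∪⁻ x∉)) b in D , inj₁ b' , eq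
BindsEx-rename⁻ x x' (or φ ψ) x∉ (inj₂ b) =
  let (D , b' , eq) = BindsEx-rename⁻ x x' ψ (proj₂ (∉-∪⁻ x∉)) b in D , inj₂ b' , eq
BindsEx-rename⁻ x x' (exQ y D φ) x∉ (inj₁ (y'≡ , refl)) =
  D , inj₁ (trans (sym (renameVar-≢ x' (x∉⁅y⁆⇒x≢y (proj₂ (∉-∪⁻ x∉)) ∘′ sym))) y'≡ , refl) , refl
BindsEx-rename⁻ x x' (exQ _ _ φ) x∉ (inj₂ b) =
  let (D , b' , eq) = BindsEx-rename⁻ x x' φ (proj₁ (∉-∪⁻ x∉)) b in D , inj₂ b' , eq
BindsEx-rename⁻ x x' (allQ _ φ) x∉ b = BindsEx-rename⁻ x x' φ x∉ b

⟦_⟧ᶜ : Conn → Bool → Bool → Bool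
⟦ ∧c ⟧ᶜ = _∧_
⟦ ∨c ⟧ᶜ = _∨_

evalF-conn : ∀ ∘ (φ ψ : DQBF n) val → evalF val (conn ∘ φ ψ) ≡ ⟦ ∘ ⟧ᶜ (evalF val φ) (evalF val ψ)
evalF-conn ∧c φ ψ val = refl
evalF-conn ∨c φ ψ val = refl

allVars-conn : ∀ ∘ (φ ψ : DQBF n) → allVars (conn ∘ φ ψ) ≡ allVars φ ∪ allVars ψ
allVars-conn ∧c φ ψ = refl
allVars-conn ∨c φ ψ = refl

exVars-conn : ∀ ∘ (φ ψ : DQBF n) → exVars (conn ∘ φ ψ) ≡ exVars φ ∪ exVars ψ
exVars-conn ∧c φ ψ = refl
exVars-conn ∨c φ ψ = refl

removeDep-conn : ∀ ∘ x (φ ψ : DQBF n) →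
                 removeDep x (conn ∘ φ ψ) ≡ conn ∘ (removeDep x φ) (removeDep x ψ)
removeDep-conn ∧c x φ ψ = refl
removeDep-conn ∨c x φ ψ = refl

BindsEx-conn⁺ : ∀ ∘ (φ ψ : DQBF n) {D} → BindsEx φ y D ⊎ BindsEx ψ y D → BindsEx (conn ∘ φ ψ) y D
BindsEx-conn⁺ ∧c φ ψ b = b
BindsEx-conn⁺ ∨c φ ψ b = b

BindsEx-conn⁻ : ∀ ∘ (φ ψ : DQBF n) {D} → BindsEx (conn ∘ φ ψ) y D → BindsEx φ y D ⊎ BindsEx ψ y D
BindsEx-conn⁻ ∧c φ ψ b = b
BindsEx-conn⁻ ∨c φ ψ b = b

-- Skolem function candidates

data Constraint (ψ : DQBF n) : Fin n → Subset n → Set where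
  bound : ∀ {y D} → BindsEx ψ y D → Constraint ψ y (D ∩ allVars ψ)
  free  : v ∉ exVars ψ → Constraint ψ v ∅

Respects : DQBF n → (Fin n → BFun n) → Set
Respects ψ s = ∀ {v P} → Constraint ψ v P → DependsOnly (s v) P

SkolemCand⇒Respects : ∀ (ψ : DQBF n) {s} → SkolemCand ψ s → Respects ψ s
SkolemCand⇒Respects ψ (deps , _)   (bound b)   = deps _ _ b
SkolemCand⇒Respects ψ (_ , consts) (free v∉ψ) = consts _ v∉ψ

Respects⇒SkolemCand : ∀ (ψ : DQBF n) {s} → Respects ψ s → SkolemCand ψ s
Respects⇒SkolemCand ψ r = (λ _ _ → r ∘′ bound) , (λ _ → r ∘′ free)

Respects-DependsOnly : ∀ (ψ : DQBF n) {s U} → Respects ψ s →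
                       (∀ {D} → BindsEx ψ v D → D ∩ allVars ψ ⊆ U) → DependsOnly (s v) U
Respects-DependsOnly {v = v} ψ r bindings⊆U with v ∈? exVars ψ
... | yes v∈ψ = let (D , b) = ∈exVars⇒BindsEx ψ v∈ψ in DependsOnly-mono (bindings⊆U b) (r (bound b))
... | no v∉ψ  = DependsOnly-mono (⊆-min _) (r (free v∉ψ))

AllConstant : (Fin n → BFun n) → Set
AllConstant s = ∀ v → DependsOnly (s v) ∅

SkolemCand-noEx : ∀ {ψ : DQBF n} {s} → Empty (exVars ψ) → SkolemCand ψ s ⇔ AllConstant s
SkolemCand-noEx {ψ = ψ} noEx = mk⇔
  (λ cand v → SkolemCand⇒Respects ψ cand (free (Empty⇒∉ noEx)))
  (λ const → Respects⇒SkolemCand ψ λ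
    { (bound b) → contradiction (BindsEx⇒∈exVars ψ b) (Empty⇒∉ noEx)
    ; (free _)  → const _ })

SkolemCand-noAll : ∀ {ψ : DQBF n} {s} → Empty (allVars ψ) → SkolemCand ψ s ⇔ AllConstant s
SkolemCand-noAll {ψ = ψ} noAll = mk⇔ const
  (λ const → Respects⇒SkolemCand ψ λ
    { (bound b) → DependsOnly-mono (⊆-min _) (const _)
    ; (free _)  → const _ })
  where
  const : ∀ {s} → SkolemCand ψ s → AllConstant s
  const cand v with v ∈? exVars ψ
  ... | no v∉ψ = SkolemCand⇒Respects ψ cand (free v∉ψ)
  ... | yes v∈ψ =
    let (D , b) = ∈exVars⇒BindsEx ψ v∈ψ
    in DependsOnly-mono (λ h → contradiction (proj₂ (x∈p∩q⁻ D _ h)) (Empty⇒∉ noAll))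
                        (SkolemCand⇒Respects ψ cand (bound b))

evalS-≡ : ∀ {ψ ψ' : DQBF n} {s a} → allVars ψ ≡ allVars ψ' →
          (∀ val → evalF val ψ ≡ evalF val ψ') → evalS ψ s a ≡ evalS ψ' s a
evalS-≡ A≡ ev≡ rewrite A≡ = ev≡ _

evalS-noAll : ∀ {ψ : DQBF n} {s a} → Empty (allVars ψ) → evalS ψ s a ≡ evalF (λ v → s v a) ψ
evalS-noAll {ψ = ψ} {s} {a} noAll = evalF-cong ψ λ v _ → extend-∉ (allVars ψ) s a (Empty⇒∉ noAll)

record _⊑_ (ψ ψ' : DQBF n) : Set where
  field
    allVars-≡   : allVars ψ ≡ allVars ψ'
    evalF-≡     : ∀ val → evalF val ψ ≡ evalF val ψ'
    constraints : ∀ {v P'} → Constraint ψ' v P' → ∃[ P ] Constraint ψ v P × P ⊆ P'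

⊑-sound : ∀ {ψ ψ' : DQBF n} → ψ ⊑ ψ' → ∀ s → Sem ψ s → Sem ψ' s
⊑-sound {ψ = ψ} {ψ'} ψ⊑ψ' s (cand , holds) =
  Respects⇒SkolemCand ψ' respects ,
  λ a → trans (sym (evalS-≡ {ψ = ψ} {ψ'} {s} allVars-≡ evalF-≡)) (holds a)
  where
  open _⊑_ ψ⊑ψ'
  respects : Respects ψ' s
  respects c = let (P , c' , P⊆) = constraints c in
    DependsOnly-mono P⊆ (SkolemCand⇒Respects ψ cand c')

⊑-antisym : ∀ {ψ ψ' : DQBF n} → ψ ⊑ ψ' → ψ' ⊑ ψ → ψ ≃ ψ'
⊑-antisym ψ⊑ψ' ψ'⊑ψ s = mk⇔ (⊑-sound ψ⊑ψ' s) (⊑-sound ψ'⊑ψ s)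

⊑-of-same-bindings : ∀ {ψ ψ' : DQBF n} → allVars ψ ≡ allVars ψ' → exVars ψ ≡ exVars ψ' →
                     (∀ val → evalF val ψ ≡ evalF val ψ') →
                     (∀ {y D} → BindsEx ψ' y D → BindsEx ψ y D) → ψ ⊑ ψ'
⊑-of-same-bindings A≡ E≡ ev≡ from = record
  { allVars-≡   = A≡
  ; evalF-≡     = ev≡
  ; constraints = λ { (bound b)    → _ , bound (from b) , ∩-reflexiveʳ A≡
                    ; (free v∉ψ') → _ , free (v∉ψ' ∘′ subst (_ ∈_) E≡) , id }
  }

≃-of-same-bindings : ∀ {ψ ψ' : DQBF n} → allVars ψ ≡ allVars ψ' → exVars ψ ≡ exVars ψ' →
                     (∀ val → evalF val ψ ≡ evalF val ψ') →
                     (∀ {y D} → BindsEx ψ y D → BindsEx ψ' y D) →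
                     (∀ {y D} → BindsEx ψ' y D → BindsEx ψ y D) → ψ ≃ ψ'
≃-of-same-bindings {ψ = ψ} {ψ'} A≡ E≡ ev≡ to from = ⊑-antisym {ψ = ψ} {ψ'}
  (⊑-of-same-bindings A≡ E≡ ev≡ from)
  (⊑-of-same-bindings (sym A≡) (sym E≡) (λ val → sym (ev≡ val)) to)

-- Equivalences

-- Dependency sets are only ever intersected with the universal variables of the whole
-- formula, so the position of a universal quantifier does not affect the Skolem functions:
-- (g), (k) and (l) hold without their side conditions.
∀-comm : ∀ x₁ x₂ (φ : DQBF n) → All x₁ (All x₂ φ) ≃ All x₂ (All x₁ φ)
∀-comm x₁ x₂ φ = ≃-of-same-bindings {ψ = All x₁ (All x₂ φ)} {All x₂ (All x₁ φ)}
  (∪-swapʳ (allVars φ) ⁅ x₂ ⁆ ⁅ x₁ ⁆) refl (λ _ → refl) id id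

∀∃-comm : ∀ x y D (φ : DQBF n) → All x (Ex y D φ) ≃ Ex y D (All x φ)
∀∃-comm x y D φ s = mk⇔ id id

∀-pushʳ : ∀ ∘ x (φ₁ φ₂ : DQBF n) → All x (conn ∘ φ₁ φ₂) ≃ conn ∘ φ₁ (All x φ₂)
∀-pushʳ ∧c x φ₁ φ₂ = ≃-of-same-bindings {ψ = All x (and φ₁ φ₂)} {and φ₁ (All x φ₂)}
  (∪-assoc (allVars φ₁) (allVars φ₂) ⁅ x ⁆) refl (λ _ → refl) id id
∀-pushʳ ∨c x φ₁ φ₂ = ≃-of-same-bindings {ψ = All x (or φ₁ φ₂)} {or φ₁ (All x φ₂)}
  (∪-assoc (allVars φ₁) (allVars φ₂) ⁅ x ⁆) refl (λ _ → refl) id id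

∃-drop : ∀ y D (φ : DQBF n) → y ∉ qVars φ → (∀ u → u ∈ D → u ∉ allVars φ) → Ex y D φ ≃ φ
∃-drop y D φ y∉φ D-fresh = ⊑-antisym {ψ = Ex y D φ} {φ} L⊑φ φ⊑L
  where
  A≡ : allVars (removeDep y φ) ≡ allVars φ
  A≡ = removeDep-allVars y φ
  E≡ : exVars (removeDep y φ) ≡ exVars φ
  E≡ = removeDep-exVars y φ

  L⊑φ : Ex y D φ ⊑ φ
  L⊑φ = record { allVars-≡ = A≡ ; evalF-≡ = evalF-removeDep y φ ; constraints = constraints }
    where
    constraints : ∀ {v P} → Constraint φ v P → ∃[ P' ] Constraint (Ex y D φ) v P' × P' ⊆ P
    constraints (bound b) =
      _ , bound (inj₂ (BindsEx-removeDep⁺ y φ b)) , ∩-reflexiveʳ A≡ ∘′ ∩-monoˡ x∈p-y⇒x∈p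
    constraints {v = v} (free v∉φ) with v ≟ y
    ... | yes refl = _ , bound (inj₁ (refl , refl)) ,
                     λ h → let (u∈D , u∈A) = x∈p∩q⁻ D _ h in
                           contradiction (subst (_ ∈_) A≡ u∈A) (D-fresh _ u∈D)
    ... | no v≢y   = _ , free (∉-∪ (v∉φ ∘′ subst (_ ∈_) E≡) (v≢y ∘′ x∈⁅y⁆⇒x≡y y)) , id

  φ⊑L : φ ⊑ Ex y D φ
  φ⊑L = record
    { allVars-≡   = sym A≡
    ; evalF-≡     = λ val → sym (evalF-removeDep y φ val)
    ; constraints = constraints
    }
    where
    constraints : ∀ {v P} → Constraint (Ex y D φ) v P → ∃[ P' ] Constraint φ v P' × P' ⊆ P
    constraints (bound (inj₁ (refl , refl))) =
      _ , free (y∉φ ∘′ exVars⊆qVars φ) , ⊆-min _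
    constraints (bound (inj₂ b)) with BindsEx-removeDep⁻ y φ b
    ... | F , b' , refl = _ , bound b' , ∩-reflexiveʳ (sym A≡) ∘′ ∩-⊆-minus (y∉φ ∘′ allVars⊆qVars φ)
    constraints (free v∉L) = _ , free (v∉L ∘′ x∈p∪q⁺ ∘′ inj₁ ∘′ subst (_ ∈_) (sym E≡)) , id

∃-pushʳ : ∀ ∘ y D (φ₁ φ₂ : DQBF n) → y ∉ allVars (conn ∘ φ₁ φ₂) →
          Ex y D (conn ∘ φ₁ φ₂) ≃ conn ∘ φ₁ (Ex y D φ₂)
∃-pushʳ ∘ y D φ₁ φ₂ y∉A =
  subst (λ χ → exQ y D χ ≃ R) (sym (removeDep-conn ∘ y φ₁ φ₂)) (⊑-antisym {ψ = L} {R} L⊑R R⊑L)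
  where
  ψ₁ = removeDep y φ₁
  ψ₂ = removeDep y φ₂
  L = exQ y D (conn ∘ ψ₁ ψ₂)
  R = conn ∘ φ₁ (exQ y D ψ₂)

  A≡ : allVars L ≡ allVars R
  A≡ = trans (allVars-conn ∘ ψ₁ ψ₂)
         (trans (cong (_∪ allVars ψ₂) (removeDep-allVars y φ₁)) (sym (allVars-conn ∘ φ₁ _)))

  E≡ : exVars L ≡ exVars R
  E≡ = trans (cong (_∪ ⁅ y ⁆) (trans (exVars-conn ∘ ψ₁ ψ₂)
                                     (cong (_∪ exVars ψ₂) (removeDep-exVars y φ₁))))
             (trans (∪-assoc (exVars φ₁) (exVars ψ₂) ⁅ y ⁆) (sym (exVars-conn ∘ φ₁ _)))

  ev≡ : ∀ val → evalF val L ≡ evalF val R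
  ev≡ val = trans (evalF-conn ∘ ψ₁ ψ₂ val)
              (trans (cong (λ b → ⟦ ∘ ⟧ᶜ b (evalF val ψ₂)) (evalF-removeDep y φ₁ val))
                     (sym (evalF-conn ∘ φ₁ _ val)))

  y∉AR : y ∉ allVars R
  y∉AR = y∉A ∘′ subst (_ ∈_) (trans (sym A≡) (trans (cong allVars (sym (removeDep-conn ∘ y φ₁ φ₂)))
                                                      (removeDep-allVars y (conn ∘ φ₁ φ₂))))

  L⊑R : L ⊑ R
  L⊑R = record { allVars-≡ = A≡ ; evalF-≡ = ev≡ ; constraints = constraints }
    where
    constraints : ∀ {v P} → Constraint R v P → ∃[ P' ] Constraint L v P' × P' ⊆ P
    constraints (free v∉R) = _ , free (v∉R ∘′ subst (_ ∈_) E≡) , id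
    constraints (bound b) with BindsEx-conn⁻ ∘ φ₁ _ b
    ... | inj₁ b₁ = _ , bound (inj₂ (BindsEx-conn⁺ ∘ ψ₁ ψ₂ (inj₁ (BindsEx-removeDep⁺ y φ₁ b₁)))) ,
                    ∩-reflexiveʳ A≡ ∘′ ∩-monoˡ x∈p-y⇒x∈p
    ... | inj₂ (inj₁ (refl , refl)) = _ , bound (inj₁ (refl , refl)) , ∩-reflexiveʳ A≡
    ... | inj₂ (inj₂ b₂) = _ , bound (inj₂ (BindsEx-conn⁺ ∘ ψ₁ ψ₂ (inj₂ b₂))) , ∩-reflexiveʳ A≡

  R⊑L : R ⊑ L
  R⊑L = record { allVars-≡ = sym A≡ ; evalF-≡ = λ val → sym (ev≡ val) ; constraints = constraints }
    where
    constraints : ∀ {v P} → Constraint L v P → ∃[ P' ] Constraint R v P' × P' ⊆ P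
    constraints (free v∉L) = _ , free (v∉L ∘′ subst (_ ∈_) (sym E≡)) , id
    constraints (bound (inj₁ (refl , refl))) =
      _ , bound (BindsEx-conn⁺ ∘ φ₁ _ (inj₂ (inj₁ (refl , refl)))) , ∩-reflexiveʳ (sym A≡)
    constraints (bound (inj₂ b)) with BindsEx-conn⁻ ∘ ψ₁ ψ₂ b
    ... | inj₂ b₂ = _ , bound (BindsEx-conn⁺ ∘ φ₁ _ (inj₂ (inj₂ b₂))) , ∩-reflexiveʳ (sym A≡)
    ... | inj₁ b₁ with BindsEx-removeDep⁻ y φ₁ b₁
    ...   | F , b₁' , refl =
      _ , bound (BindsEx-conn⁺ ∘ φ₁ _ (inj₁ b₁')) , ∩-reflexiveʳ (sym A≡) ∘′ ∩-⊆-minus y∉AR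

Ex-swap-⊑ : ∀ y₁ y₂ D₁ D₂ (φ : DQBF n) → y₂ ∉ allVars φ →
            Ex y₁ D₁ (Ex y₂ D₂ φ) ⊑ Ex y₂ D₂ (Ex y₁ D₁ φ)
Ex-swap-⊑ y₁ y₂ D₁ D₂ φ y₂∉φ = record
  { allVars-≡   = A≡
  ; evalF-≡     = λ val → cong (evalF val) X≡Y
  ; constraints = constraints
  }
  where
  X≡Y : removeDep y₁ (removeDep y₂ φ) ≡ removeDep y₂ (removeDep y₁ φ)
  X≡Y = removeDep-comm y₁ y₂ φ
  A≡ : allVars (removeDep y₁ (removeDep y₂ φ)) ≡ allVars (removeDep y₂ (removeDep y₁ φ))
  A≡ = cong allVars X≡Y
  y₂∉L : y₂ ∉ allVars (removeDep y₁ (removeDep y₂ φ))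
  y₂∉L = y₂∉φ ∘′ subst (_ ∈_) (trans (removeDep-allVars y₁ (removeDep y₂ φ)) (removeDep-allVars y₂ φ))

  constraints : ∀ {v P} → Constraint (Ex y₂ D₂ (Ex y₁ D₁ φ)) v P →
                ∃[ P' ] Constraint (Ex y₁ D₁ (Ex y₂ D₂ φ)) v P' × P' ⊆ P
  constraints (free v∉R) =
    _ , free (v∉R ∘′ subst (_ ∈_) (trans (cong (λ χ → (exVars χ ∪ ⁅ y₂ ⁆) ∪ ⁅ y₁ ⁆) X≡Y)
                                          (∪-swapʳ _ ⁅ y₂ ⁆ ⁅ y₁ ⁆))) , id
  constraints (bound (inj₁ (refl , refl))) =
    _ , bound (inj₂ (inj₁ (refl , refl))) , ∩-reflexiveʳ A≡ ∘′ ∩-monoˡ x∈p-y⇒x∈p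
  constraints (bound (inj₂ (inj₁ (refl , refl)))) =
    _ , bound (inj₁ (refl , refl)) , ∩-reflexiveʳ A≡ ∘′ ∩-⊆-minus y₂∉L
  constraints (bound (inj₂ (inj₂ b))) =
    _ , bound (inj₂ (inj₂ (subst (λ χ → BindsEx χ _ _) (sym X≡Y) b))) , ∩-reflexiveʳ A≡

∃-comm : ∀ y₁ y₂ D₁ D₂ (φ : DQBF n) → y₁ ∉ allVars φ → y₂ ∉ allVars φ →
         Ex y₁ D₁ (Ex y₂ D₂ φ) ≃ Ex y₂ D₂ (Ex y₁ D₁ φ)
∃-comm y₁ y₂ D₁ D₂ φ y₁∉φ y₂∉φ = ⊑-antisym {ψ = Ex y₁ D₁ (Ex y₂ D₂ φ)} {Ex y₂ D₂ (Ex y₁ D₁ φ)}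
  (Ex-swap-⊑ y₁ y₂ D₁ D₂ φ y₂∉φ) (Ex-swap-⊑ y₂ y₁ D₂ D₁ φ y₁∉φ)

∀-expand : ∀ x (φ : DQBF n) → Empty (allVars φ) → Empty (exVars φ) →
           All x φ ≃ and (substConst x false φ) (substConst x true φ)
∀-expand {n} x φ noAll noEx s = mk⇔ to from
  where
  R = and (substConst x false φ) (substConst x true φ)

  noAllR : Empty (allVars R)
  noAllR = Empty-∪ (subst Empty (sym (substConst-allVars x false φ)) noAll)
                   (subst Empty (sym (substConst-allVars x true φ)) noAll)
  candL⇔ : SkolemCand (All x φ) s ⇔ AllConstant s
  candL⇔ = SkolemCand-noEx {ψ = All x φ} noEx
  candR⇔ : SkolemCand R s ⇔ AllConstant s
  candR⇔ = SkolemCand-noAll {ψ = R} noAllR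

  inst : Assignment n → Bool → Bool
  inst a b = evalF ((λ v → s v a) [ x ≔ b ]) φ

  inst-constant : AllConstant s → ∀ a a' b → inst a b ≡ inst a' b
  inst-constant const a a' b =
    evalF-cong φ λ v _ → update-cong _ _ x b λ u _ → constant (const u) a a'

  L-at : ∀ a → evalS (All x φ) s a ≡ inst a (a x)
  L-at a = evalF-cong φ λ v _ → pointwise v
    where
    pointwise : ∀ v → extend (allVars φ ∪ ⁅ x ⁆) s a v ≡ ((λ v → s v a) [ x ≔ a x ]) v
    pointwise v with v ≟ x
    ... | yes refl = extend-∈ (allVars φ ∪ ⁅ x ⁆) s a (x∈p∪q⁺ (inj₂ (x∈⁅x⁆ x)))
    ... | no v≢x   = extend-∉ (allVars φ ∪ ⁅ x ⁆) s a (∉-∪ (Empty⇒∉ noAll) (v≢x ∘′ x∈⁅y⁆⇒x≡y x))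

  R-at : ∀ a → evalS R s a ≡ inst a false ∧ inst a true
  R-at a = trans (evalS-noAll {ψ = R} {s} noAllR)
                 (cong₂ _∧_ (evalF-substConst x false φ _) (evalF-substConst x true φ _))

  to : Sem (All x φ) s → Sem R s
  to (cand , holds) =
    Equivalence.from candR⇔ const ,
    λ a → trans (R-at a) (∧-≡true⁺ (inst-holds a false) (inst-holds a true))
    where
    const = Equivalence.to candL⇔ cand
    inst-holds : ∀ a b → inst a b ≡ true
    inst-holds a b = trans (inst-constant const a (λ _ → b) b)
                           (trans (sym (L-at (λ _ → b))) (holds (λ _ → b)))

  from : Sem R s → Sem (All x φ) s
  from (cand , holds) =
    Equivalence.from candL⇔ (Equivalence.to candR⇔ cand) ,
    λ a → trans (L-at a) (∧-select (inst a) (a x) (trans (sym (R-at a)) (holds a)))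

-- Equisatisfiabilities

∃-expand : ∀ y D (φ : DQBF n) → Empty (allVars φ) →
           Ex y D φ ≈ or (substConst y false φ) (substConst y true φ)
∃-expand {n} y D φ noAll = mk⇔ to from
  where
  L = Ex y D φ
  R = or (substConst y false φ) (substConst y true φ)

  noAllL : Empty (allVars L)
  noAllL = subst Empty (sym (removeDep-allVars y φ)) noAll
  candL⇔ : ∀ {s} → SkolemCand L s ⇔ AllConstant s
  candL⇔ = SkolemCand-noAll {ψ = L} noAllL
  noAllR : Empty (allVars R)
  noAllR = Empty-∪ (subst Empty (sym (substConst-allVars y false φ)) noAll)
                   (subst Empty (sym (substConst-allVars y true φ)) noAll)
  candR⇔ : ∀ {s} → SkolemCand R s ⇔ AllConstant s
  candR⇔ = SkolemCand-noAll {ψ = R} noAllR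

  inst : (Fin n → BFun n) → Assignment n → Bool → Bool
  inst s a b = evalF ((λ v → s v a) [ y ≔ b ]) φ

  inst-constant : ∀ {s} → AllConstant s → ∀ a a' b → inst s a b ≡ inst s a' b
  inst-constant const a a' b =
    evalF-cong φ λ v _ → update-cong _ _ y b λ u _ → constant (const u) a a'

  L-at : ∀ s a → evalS L s a ≡ evalF (λ v → s v a) φ
  L-at s a = trans (evalS-noAll {ψ = L} {s} noAllL) (evalF-removeDep y φ _)

  R-at : ∀ s a → evalS R s a ≡ inst s a false ∨ inst s a true
  R-at s a = trans (evalS-noAll {ψ = R} {s} noAllR)
                   (cong₂ _∨_ (evalF-substConst y false φ _) (evalF-substConst y true φ _))

  to : Satisfiable L → Satisfiable R
  to (s , cand , holds) =
    s , Equivalence.from candR⇔ (Equivalence.to candL⇔ cand) ,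
    λ a → trans (R-at s a)
                (∨-intro (inst s a) (s y a) (trans (evalF-cong φ λ v _ → update-self (λ u → s u a) v)
                                                   (trans (sym (L-at s a)) (holds a))))
    where
    update-self : ∀ (f : Assignment n) v → (f [ y ≔ f y ]) v ≡ f v
    update-self f v with v ≟ y
    ... | yes refl = refl
    ... | no _     = refl

  from : Satisfiable R → Satisfiable L
  from (s , cand , holds) =
    s' , Equivalence.from candL⇔ const' ,
    λ a → trans (L-at s' a) (trans (evalF-cong φ λ v _ → update-apply v)
                                   (trans (inst-constant const a a₀ c) inst-c))
    where
    const = Equivalence.to candR⇔ cand
    a₀ : Assignment n
    a₀ _ = false
    -- all Skolem functions are constants, so y can take a constant that satisfies φ
    witness = ∨-witness (inst s a₀) (trans (sym (R-at s a₀)) (holds a₀))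
    c = proj₁ witness
    inst-c = proj₂ witness
    s' : Fin n → BFun n
    s' = s [ y ≔ (λ _ → c) ]

    const' : AllConstant s'
    const' v with v ≟ y
    ... | yes _ = λ _ _ _ → refl
    ... | no _  = const v
    update-apply : ∀ {a} v → s' v a ≡ ((λ u → s u a) [ y ≔ c ]) v
    update-apply v with v ≟ y
    ... | yes _ = refl
    ... | no _  = refl

∀-drop : ∀ x (φ : DQBF n) → x ∉ occVars φ → All x φ ≈ removeDep x φ
∀-drop {n} x φ x∉φ = mk⇔ to from
  where
  L = All x φ
  R = removeDep x φ
  A≡ : allVars R ≡ allVars φ
  A≡ = removeDep-allVars x φ
  E≡ : exVars R ≡ exVars φ
  E≡ = removeDep-exVars x φ

  R⇒L : ∀ {v} → v ∈ allVars R → v ∈ allVars L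
  R⇒L = x∈p∪q⁺ ∘′ inj₁ ∘′ subst (_ ∈_) A≡
  L⇒R : ∀ {v} → v ≢ x → v ∈ allVars L → v ∈ allVars R
  L⇒R v≢x h with x∈p∪q⁻ (allVars φ) ⁅ x ⁆ h
  ... | inj₁ h' = subst (_ ∈_) (sym A≡) h'
  ... | inj₂ h' = contradiction (x∈⁅y⁆⇒x≡y x h') v≢x
  Occurs⇒≢x : ∀ {v} → Occurs v φ → v ≢ x
  Occurs⇒≢x = Occurs-∉occVars φ x∉φ

  to : Satisfiable L → Satisfiable R
  to (s , cand , holds) =
    s' , Respects⇒SkolemCand R respects ,
    λ a → trans (evalF-removeDep x φ _)
            (trans (evalF-cong φ λ v o → extend-≡ s' a s (a [ x ≔ false ]) R⇒L (L⇒R (Occurs⇒≢x o))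
                                            (λ _ → sym (update-≢ a false (Occurs⇒≢x o))) (λ _ → refl))
                   (holds (a [ x ≔ false ])))
    where
    s' : Fin n → BFun n
    s' v a = s v (a [ x ≔ false ])
    respects : Respects R s'
    respects (bound b) with BindsEx-removeDep⁻ x φ b
    ... | F , b' , refl = DependsOnly-∘ (SkolemCand⇒Respects L cand (bound b'))
      λ _ _ a≈a' → Agree-update (λ h u≢x → let (u∈F , u∈L) = x∈p∩q⁻ F _ h in
                                           x∈p∩q⁺ (x∈p∧x≢y⇒x∈p-y u∈F u≢x , L⇒R u≢x u∈L))
                                 a≈a' (λ _ → refl)
    respects (free v∉R) = constant-∘ (SkolemCand⇒Respects L cand (free (v∉R ∘′ subst (_ ∈_) (sym E≡))))

  from : Satisfiable R → Satisfiable L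
  from (s , cand , holds) =
    s , Respects⇒SkolemCand L respects ,
    λ a → trans (evalF-cong φ λ v o →
                   extend-≡ s a s a (L⇒R (Occurs⇒≢x o)) R⇒L (λ _ → refl) (λ _ → refl))
                (trans (sym (evalF-removeDep x φ _)) (holds a))
    where
    respects : Respects L s
    respects (bound b) = DependsOnly-mono (∩-mono x∈p-y⇒x∈p R⇒L)
                           (SkolemCand⇒Respects R cand (bound (BindsEx-removeDep⁺ x φ b)))
    respects (free v∉L) = SkolemCand⇒Respects R cand (free (v∉L ∘′ subst (_ ∈_) E≡))

∀-pushʳ-≈ : ∀ x (φ₁ φ₂ : DQBF n) → Compatible φ₁ φ₂ → Compatible φ₂ φ₁ → x ∉ occVars φ₁ →
            All x (and φ₁ φ₂) ≈ and (removeDep x φ₁) (All x φ₂)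
∀-pushʳ-≈ {n} x φ₁ φ₂ c₁₂ c₂₁ x∉φ₁ = mk⇔ to (λ (s , sem) → s , ⊑-sound R⊑L s sem)
  where
  ψ₁ = removeDep x φ₁
  L = All x (and φ₁ φ₂)
  R = and ψ₁ (All x φ₂)

  A≡ : allVars R ≡ allVars L
  A≡ = trans (cong (_∪ _) (removeDep-allVars x φ₁)) (sym (∪-assoc (allVars φ₁) (allVars φ₂) ⁅ x ⁆))
  E≡ : exVars R ≡ exVars L
  E≡ = cong (_∪ exVars φ₂) (removeDep-exVars x φ₁)
  R⇒L : ∀ {v} → v ∈ allVars R → v ∈ allVars L
  R⇒L = subst (_ ∈_) A≡
  L⇒R : ∀ {v} → v ∈ allVars L → v ∈ allVars R
  L⇒R = subst (_ ∈_) (sym A≡)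

  R⊑L : R ⊑ L
  R⊑L = record
    { allVars-≡   = A≡
    ; evalF-≡     = λ val → cong (_∧ evalF val φ₂) (evalF-removeDep x φ₁ val)
    ; constraints = λ
      { (bound (inj₁ b)) → _ , bound (inj₁ (BindsEx-removeDep⁺ x φ₁ b)) , ∩-mono x∈p-y⇒x∈p R⇒L
      ; (bound (inj₂ b)) → _ , bound (inj₂ b) , ∩-reflexiveʳ A≡
      ; (free v∉L)       → _ , free (v∉L ∘′ subst (_ ∈_) E≡) , id
      }
    }

  to : Satisfiable L → Satisfiable R
  to (s , cand , holds) = s' , Respects⇒SkolemCand R respects , λ a → ∧-≡true⁺ (holds₁ a) (holds₂ a)
    where
    -- the Skolem functions of φ₁ no longer see x: fix it to false
    s' : Fin n → BFun n
    s' v a = s v (if lookup (exVars φ₁) v then a [ x ≔ false ] else a)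

    s'-∈ : ∀ {v} a → v ∈ exVars φ₁ → s' v a ≡ s v (a [ x ≔ false ])
    s'-∈ a v∈φ₁ rewrite []=⇒lookup v∈φ₁ = refl
    s'-∉ : ∀ {v} a → v ∉ exVars φ₁ → s' v a ≡ s v a
    s'-∉ a v∉φ₁ rewrite x∉p⇒lookup≡false v∉φ₁ = refl

    respectsL : Respects L s
    respectsL = SkolemCand⇒Respects L cand

    respects : Respects R s'
    respects (bound (inj₁ b)) with BindsEx-removeDep⁻ x φ₁ b
    ... | F , b' , refl = DependsOnly-≗ (λ a → s'-∈ a (BindsEx⇒∈exVars φ₁ b'))
      (DependsOnly-∘ (respectsL (bound (inj₁ b')))
        λ _ _ a≈a' → Agree-update (λ h u≢x → let (u∈F , u∈L) = x∈p∩q⁻ F _ h in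
                                             x∈p∩q⁺ (x∈p∧x≢y⇒x∈p-y u∈F u≢x , L⇒R u∈L))
                                   a≈a' (λ _ → refl))
    respects (bound (inj₂ b)) = DependsOnly-≗ (λ a → s'-∉ a z∉φ₁)
                                  (DependsOnly-mono (∩-reflexiveʳ (sym A≡)) (respectsL (bound (inj₂ b))))
      where
      z∉φ₁ = Compatible-qVars φ₂ φ₁ c₂₁ (exVars⊆qVars φ₂ (BindsEx⇒∈exVars φ₂ b)) ∘′ exVars⊆qVars φ₁
    respects (free v∉R) = DependsOnly-≗ (λ a → s'-∉ a (v∉L ∘′ x∈p∪q⁺ ∘′ inj₁)) (respectsL (free v∉L))
      where
      v∉L = v∉R ∘′ subst (_ ∈_) (sym E≡)

    holds₁ : ∀ a → evalF (extend (allVars R) s' a) ψ₁ ≡ true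
    holds₁ a = trans (evalF-removeDep x φ₁ _)
                 (trans (evalF-cong φ₁ λ v o →
                           extend-≡ s' a s (a [ x ≔ false ]) R⇒L L⇒R
                             (λ _ → sym (update-≢ a false (Occurs-∉occVars φ₁ x∉φ₁ o)))
                             (λ _ → off o))
                        (proj₁ (∧-≡true (holds (a [ x ≔ false ])))))
      where
      off : ∀ {v} → Occurs v φ₁ → s' v a ≡ s v (a [ x ≔ false ])
      off {v} o with v ∈? exVars φ₁
      ... | yes v∈φ₁ = s'-∈ a v∈φ₁
      ... | no v∉φ₁  = trans (s'-∉ a v∉φ₁)
                         (constant (respectsL (free (∉-∪ v∉φ₁ v∉φ₂))) _ _)
        where
        v∉φ₂ = Compatible-Occurs φ₁ φ₂ c₁₂ o ∘′ exVars⊆qVars φ₂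

    holds₂ : ∀ a → evalF (extend (allVars R) s' a) φ₂ ≡ true
    holds₂ a = trans (evalF-cong φ₂ λ v o →
                        extend-≡ s' a s a R⇒L L⇒R (λ _ → refl)
                          (λ _ → s'-∉ a (Compatible-Occurs φ₂ φ₁ c₂₁ o ∘′ exVars⊆qVars φ₁)))
                     (proj₂ (∧-≡true (holds a)))

∀-distrib-∧ : ∀ x x' (φ₁ φ₂ : DQBF n) → Compatible φ₁ φ₂ → Compatible φ₂ φ₁ → x ∉ qVars φ₂ →
              x' ∉ occVars φ₁ → x' ∉ depVars φ₁ → x' ∉ occVars φ₂ → x' ∉ depVars φ₂ →
              All x (and φ₁ φ₂) ≈ and (All x φ₁) (All x' (rename x x' φ₂))
∀-distrib-∧ {n} x x' φ₁ φ₂ c₁₂ c₂₁ x∉φ₂ x'∉φ₁ x'∉D₁ x'∉φ₂ x'∉D₂ = mk⇔ to from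
  where
  χ = rename x x' φ₂
  L = All x (and φ₁ φ₂)
  R = and (All x φ₁) (All x' χ)

  x∉E₂ : x ∉ exVars φ₂
  x∉E₂ = x∉φ₂ ∘′ exVars⊆qVars φ₂
  Aχ≡ : allVars χ ≡ allVars φ₂
  Aχ≡ = rename-allVars x x' φ₂ (x∉φ₂ ∘′ allVars⊆qVars φ₂)
  E≡ : exVars R ≡ exVars L
  E≡ = cong (exVars φ₁ ∪_) (rename-exVars x x' φ₂ x∉E₂)

  x∈L : x ∈ allVars L
  x∈L = x∈p∪q⁺ (inj₂ (x∈⁅x⁆ x))
  x'∈R : x' ∈ allVars R
  x'∈R = x∈p∪q⁺ (inj₂ (x∈p∪q⁺ (inj₂ (x∈⁅x⁆ x'))))

  L⇒R : ∀ {v} → v ∈ allVars L → v ∈ allVars R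
  L⇒R h with x∈p∪q⁻ _ ⁅ x ⁆ h
  ... | inj₂ h' = x∈p∪q⁺ (inj₁ (x∈p∪q⁺ (inj₂ h')))
  ... | inj₁ h' with x∈p∪q⁻ (allVars φ₁) _ h'
  ...   | inj₁ h₁ = x∈p∪q⁺ (inj₁ (x∈p∪q⁺ (inj₁ h₁)))
  ...   | inj₂ h₂ = x∈p∪q⁺ (inj₂ (x∈p∪q⁺ (inj₁ (subst (_ ∈_) (sym Aχ≡) h₂))))

  R⇒L : ∀ {v} → v ∈ allVars R → v ≢ x' → v ∈ allVars L
  R⇒L h v≢x' with x∈p∪q⁻ (allVars φ₁ ∪ ⁅ x ⁆) _ h
  ... | inj₁ h' = ∪-mono (x∈p∪q⁺ ∘′ inj₁) id h'
  ... | inj₂ h' with x∈p∪q⁻ (allVars χ) ⁅ x' ⁆ h'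
  ...   | inj₁ h₂ = x∈p∪q⁺ (inj₁ (x∈p∪q⁺ (inj₂ (subst (_ ∈_) Aχ≡ h₂))))
  ...   | inj₂ h₂ = contradiction (x∈⁅y⁆⇒x≡y x' h₂) v≢x'

  to : Satisfiable L → Satisfiable R
  to (s , cand , holds) = s' , Respects⇒SkolemCand R respects , λ a → ∧-≡true⁺ (holds₁ a) (holds₂ a)
    where
    -- x is renamed to x' in φ₂, so the Skolem functions of φ₂ read x' where they read x
    θ : Assignment n → Assignment n
    θ a = a [ x ≔ a x' ]
    s' : Fin n → BFun n
    s' v a = s v (if lookup (exVars φ₁) v then a else θ a)

    s'-∈ : ∀ {v} a → v ∈ exVars φ₁ → s' v a ≡ s v a
    s'-∈ a v∈φ₁ rewrite []=⇒lookup v∈φ₁ = refl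
    s'-∉ : ∀ {v} a → v ∉ exVars φ₁ → s' v a ≡ s v (θ a)
    s'-∉ a v∉φ₁ rewrite x∉p⇒lookup≡false v∉φ₁ = refl

    respectsL : Respects L s
    respectsL = SkolemCand⇒Respects L cand

    respects : Respects R s'
    respects (bound (inj₁ b)) = DependsOnly-≗ (λ a → s'-∈ a (BindsEx⇒∈exVars φ₁ b))
                                  (DependsOnly-mono (∩-mono id L⇒R) (respectsL (bound (inj₁ b))))
    respects (bound (inj₂ b)) with BindsEx-rename⁻ x x' φ₂ x∉E₂ b
    ... | F , b' , refl = DependsOnly-≗ (λ a → s'-∉ a z∉φ₁)
      (DependsOnly-∘ (respectsL (bound (inj₂ b')))
        λ a a' a≈a' → Agree-update
          (λ h u≢x → let (u∈F , u∈L) = x∈p∩q⁻ F _ h in x∈p∩q⁺ (∈renameSet⁺ x' F u∈F u≢x , L⇒R u∈L))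
          a≈a' (λ h → a≈a' x' (x∈p∩q⁺ (x'∈renameSet x' F (proj₁ (x∈p∩q⁻ F _ h)) , x'∈R))))
      where
      z∉φ₁ = Compatible-qVars φ₂ φ₁ c₂₁ (exVars⊆qVars φ₂ (BindsEx⇒∈exVars φ₂ b')) ∘′ exVars⊆qVars φ₁
    respects (free v∉R) = constant-∘ (respectsL (free (v∉R ∘′ subst (_ ∈_) (sym E≡))))

    holds₁ : ∀ a → evalF (extend (allVars R) s' a) φ₁ ≡ true
    holds₁ a = trans (evalF-cong φ₁ λ v o →
                        extend-≡ s' a s a (λ h → R⇒L h (Occurs-∉occVars φ₁ x'∉φ₁ o)) L⇒R
                                 (λ _ → refl) (λ _ → off o))
                     (proj₁ (∧-≡true (holds a)))
      where
      off : ∀ {v} → Occurs v φ₁ → s' v a ≡ s v a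
      off {v} o with v ∈? exVars φ₁
      ... | yes v∈φ₁ = s'-∈ a v∈φ₁
      ... | no v∉φ₁  = trans (s'-∉ a v∉φ₁)
                         (constant (respectsL (free (∉-∪ v∉φ₁ v∉φ₂))) _ _)
        where
        v∉φ₂ = Compatible-Occurs φ₁ φ₂ c₁₂ o ∘′ exVars⊆qVars φ₂

    holds₂ : ∀ a → evalF (extend (allVars R) s' a) χ ≡ true
    holds₂ a = trans (evalF-rename x x' φ₂ _)
                 (trans (evalF-cong φ₂ pointwise) (proj₂ (∧-≡true (holds (θ a)))))
      where
      pointwise : ∀ v → Occurs v φ₂ →
                  extend (allVars R) s' a (renameVar x x' v) ≡ extend (allVars L) s (θ a) v
      pointwise v o = by-cases (v ≟ x)
        where
        by-cases : Dec (v ≡ x) →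
                   extend (allVars R) s' a (renameVar x x' v) ≡ extend (allVars L) s (θ a) v
        by-cases (yes refl) =
          trans (cong (extend (allVars R) s' a) (renameVar-≡ x x'))
                (trans (extend-∈ (allVars R) s' a x'∈R)
                       (trans (sym (update-≡ a x (a x'))) (sym (extend-∈ (allVars L) s (θ a) x∈L))))
        by-cases (no v≢x) =
          trans (cong (extend (allVars R) s' a) (renameVar-≢ x' v≢x))
                (extend-≡ s' a s (θ a) (λ h → R⇒L h (Occurs-∉occVars φ₂ x'∉φ₂ o)) L⇒R
                          (λ _ → sym (update-≢ a (a x') v≢x))
                          (λ _ → s'-∉ a (Compatible-Occurs φ₂ φ₁ c₂₁ o ∘′ exVars⊆qVars φ₁)))

  from : Satisfiable R → Satisfiable L
  from (s , cand , holds) = s' , Respects⇒SkolemCand L respects , λ a → ∧-≡true⁺ (holds₁ a) (holds₂ a)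
    where
    -- x' is universal only in R: give it the value of x
    κ : Assignment n → Assignment n
    κ a = a [ x' ≔ a x ]
    s' : Fin n → BFun n
    s' v = s v ∘′ κ

    respectsR : Respects R s
    respectsR = SkolemCand⇒Respects R cand

    respects : Respects L s'
    respects (bound (inj₁ b)) = DependsOnly-∘ (respectsR (bound (inj₁ b)))
      λ a a' a≈a' → Agree-update
        (λ h u≢x' → let (u∈E , u∈R) = x∈p∩q⁻ _ _ h in x∈p∩q⁺ (u∈E , R⇒L u∈R u≢x'))
        a≈a' (λ h → contradiction (BindsEx⇒⊆depVars φ₁ b (proj₁ (x∈p∩q⁻ _ _ h))) x'∉D₁)
    respects (bound {D = F} (inj₂ b)) =
      DependsOnly-∘ (respectsR (bound (inj₂ (BindsEx-rename⁺ x x' φ₂ x∉E₂ b))))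
      λ a a' a≈a' → Agree-update
        (λ h u≢x' → let (u∈F' , u∈R) = x∈p∩q⁻ _ _ h in
           case ∈renameSet⁻ x' F u∈F' of λ
             { (inj₁ (u≡x' , _))  → contradiction u≡x' u≢x'
             ; (inj₂ (u∈F , _))   → x∈p∩q⁺ (u∈F , R⇒L u∈R u≢x') })
        a≈a'
        (λ h → case ∈renameSet⁻ x' F (proj₁ (x∈p∩q⁻ _ _ h)) of λ
             { (inj₁ (_ , x∈F))   → a≈a' x (x∈p∩q⁺ (x∈F , x∈L))
             ; (inj₂ (x'∈F , _))  → contradiction (BindsEx⇒⊆depVars φ₂ b x'∈F) x'∉D₂ })
    respects (free v∉L) = constant-∘ (respectsR (free (v∉L ∘′ subst (_ ∈_) E≡)))

    pointwise : ∀ a {v} → v ≢ x' → extend (allVars L) s' a v ≡ extend (allVars R) s (κ a) v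
    pointwise a v≢x' = extend-≡ s' a s (κ a) L⇒R (λ h → R⇒L h v≢x')
                         (λ _ → sym (update-≢ a (a x) v≢x')) (λ _ → refl)

    holds₁ : ∀ a → evalF (extend (allVars L) s' a) φ₁ ≡ true
    holds₁ a = trans (evalF-cong φ₁ λ v o → pointwise a (Occurs-∉occVars φ₁ x'∉φ₁ o))
                     (proj₁ (∧-≡true (holds (κ a))))

    holds₂ : ∀ a → evalF (extend (allVars L) s' a) φ₂ ≡ true
    holds₂ a = trans (evalF-cong φ₂ pw)
                     (trans (sym (evalF-rename x x' φ₂ _)) (proj₂ (∧-≡true (holds (κ a)))))
      where
      pw : ∀ v → Occurs v φ₂ →
           extend (allVars L) s' a v ≡ extend (allVars R) s (κ a) (renameVar x x' v)
      pw v o = by-cases (v ≟ x)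
        where
        by-cases : Dec (v ≡ x) →
                   extend (allVars L) s' a v ≡ extend (allVars R) s (κ a) (renameVar x x' v)
        by-cases (yes refl) =
          trans (extend-∈ (allVars L) s' a x∈L)
                (trans (sym (update-≡ a x' (a x)))
                       (trans (sym (extend-∈ (allVars R) s (κ a) x'∈R))
                              (cong (extend (allVars R) s (κ a)) (sym (renameVar-≡ x x')))))
        by-cases (no v≢x) =
          trans (pointwise a (Occurs-∉occVars φ₂ x'∉φ₂ o))
                (cong (extend (allVars R) s (κ a)) (sym (renameVar-≢ x' v≢x)))

∃-distrib-∨ : ∀ y y' D (φ₁ φ₂ : DQBF n) → 𝒟 (Ex y D (or φ₁ φ₂)) → y ≢ y' →
              y' ∉ occVars φ₁ → y' ∉ occVars φ₂ → y' ∉ depVars φ₂ →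
              Ex y D (or φ₁ φ₂) ≈ or (Ex y D φ₁) (Ex y' D (rename y y' φ₂))
∃-distrib-∨ {n} y y' D φ₁ φ₂ d y≢y' y'∉φ₁ y'∉φ₂ y'∉D₂ with 𝒟-exQ⁻ d
... | d-or _ _ c₁₂ c₂₁ , y∉Q , D-fresh = mk⇔ to from
  where
  ψ₁ = removeDep y φ₁
  ψ₂ = removeDep y φ₂
  χ = removeDep y' (rename y y' φ₂)
  L = Ex y D (or φ₁ φ₂)
  R = or (Ex y D φ₁) (Ex y' D (rename y y' φ₂))

  y∉φ₂ : y ∉ qVars φ₂
  y∉φ₂ = y∉Q ∘′ ∪-mono (x∈p∪q⁺ ∘′ inj₂) (x∈p∪q⁺ ∘′ inj₂) ∘′ subst (_ ∈_) (sym (removeDep-qVars y φ₂))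
  y∉E₂ : y ∉ exVars φ₂
  y∉E₂ = y∉φ₂ ∘′ exVars⊆qVars φ₂
  y'∉ψ₁ : y' ∉ occVars ψ₁
  y'∉ψ₁ = y'∉φ₁ ∘′ subst (_ ∈_) (removeDep-occVars y φ₁)
  y'∉ψ₂ : y' ∉ occVars ψ₂
  y'∉ψ₂ = y'∉φ₂ ∘′ subst (_ ∈_) (removeDep-occVars y φ₂)

  Aχ≡ : allVars χ ≡ allVars ψ₂
  Aχ≡ = trans (removeDep-allVars y' (rename y y' φ₂))
          (trans (rename-allVars y y' φ₂ (y∉φ₂ ∘′ allVars⊆qVars φ₂)) (sym (removeDep-allVars y φ₂)))
  Eχ≡ : exVars χ ≡ exVars ψ₂
  Eχ≡ = trans (removeDep-exVars y' (rename y y' φ₂))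
          (trans (rename-exVars y y' φ₂ y∉E₂) (sym (removeDep-exVars y φ₂)))
  A≡ : allVars R ≡ allVars L
  A≡ = cong (allVars ψ₁ ∪_) Aχ≡
  R⇒L : ∀ {v} → v ∈ allVars R → v ∈ allVars L
  R⇒L = subst (_ ∈_) A≡
  L⇒R : ∀ {v} → v ∈ allVars L → v ∈ allVars R
  L⇒R = subst (_ ∈_) (sym A≡)

  y∉L : y ∉ allVars L
  y∉L = y∉Q ∘′ allVars⊆qVars (or ψ₁ ψ₂)
  y'∉R : y' ∉ allVars R
  y'∉R h with x∈p∪q⁻ (allVars ψ₁) (allVars ψ₂) (R⇒L h)
  ... | inj₁ h₁ = y'∉ψ₁ (x∈p∪q⁺ (inj₁ (allVars⊆qVars ψ₁ h₁)))
  ... | inj₂ h₂ = y'∉ψ₂ (x∈p∪q⁺ (inj₁ (allVars⊆qVars ψ₂ h₂)))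
  D∩R≡∅ : ∀ {v} → v ∈ D ∩ allVars R → v ∈ ∅
  D∩R≡∅ h = let (v∈D , v∈R) = x∈p∩q⁻ D _ h in
    contradiction (allVars⊆qVars (or ψ₁ ψ₂) (R⇒L v∈R)) (D-fresh _ v∈D)

  BindsEx-χ⁻ : ∀ {z E} → BindsEx χ z E → BindsEx ψ₂ z E
  BindsEx-χ⁻ b with BindsEx-removeDep⁻ y' (rename y y' φ₂) b
  ... | _ , b' , refl with BindsEx-rename⁻ y y' φ₂ y∉E₂ b'
  ...   | F , b'' , refl =
    subst (BindsEx ψ₂ _) (sym (renameSet-minus y y' F (y'∉D₂ ∘′ BindsEx⇒⊆depVars φ₂ b'')))
          (BindsEx-removeDep⁺ y φ₂ b'')
  BindsEx-χ⁺ : ∀ {z E} → BindsEx ψ₂ z E → BindsEx χ z E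
  BindsEx-χ⁺ b with BindsEx-removeDep⁻ y φ₂ b
  ... | F , b' , refl =
    subst (BindsEx χ _) (renameSet-minus y y' F (y'∉D₂ ∘′ BindsEx⇒⊆depVars φ₂ b'))
          (BindsEx-removeDep⁺ y' (rename y y' φ₂) (BindsEx-rename⁺ y y' φ₂ y∉E₂ b'))

  evalF-χ : ∀ val → evalF val χ ≡ evalF (val ∘′ renameVar y y') ψ₂
  evalF-χ val = trans (evalF-removeDep y' (rename y y' φ₂) val)
                  (trans (evalF-rename y y' φ₂ val) (sym (evalF-removeDep y φ₂ _)))

  by-renaming : ∀ {val val'} → val' y' ≡ val y → (∀ {v} → Occurs v φ₂ → v ≢ y → val' v ≡ val v) →
                evalF val' χ ≡ evalF val ψ₂
  by-renaming {val} {val'} at-y elsewhere =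
    trans (evalF-χ val') (trans (evalF-removeDep y φ₂ _)
                               (trans (evalF-cong φ₂ pointwise) (sym (evalF-removeDep y φ₂ _))))
    where
    pointwise : ∀ v → Occurs v φ₂ → val' (renameVar y y' v) ≡ val v
    pointwise v o with v ≟ y
    ... | yes refl = at-y
    ... | no v≢y   = elsewhere o v≢y

  to : Satisfiable L → Satisfiable R
  to (s , cand , holds) = s' , Respects⇒SkolemCand R respects , λ a → trans (holds-≡ a) (holds a)
    where
    s' : Fin n → BFun n
    s' = s [ y' ≔ s y ]
    s'≗s : ∀ {v} → v ≢ y' → ∀ a → s' v a ≡ s v a
    s'≗s v≢y' a = cong (λ f → f a) (update-≢ s (s y) v≢y')

    respectsL : Respects L s
    respectsL = SkolemCand⇒Respects L cand
    from-L : ∀ {v D} → v ≢ y' → Constraint L v (D ∩ allVars L) → DependsOnly (s' v) (D ∩ allVars R)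
    from-L v≢y' c = DependsOnly-≗ (s'≗s v≢y') (DependsOnly-mono (∩-reflexiveʳ (sym A≡)) (respectsL c))

    respects : Respects R s'
    respects (bound (inj₁ (inj₁ (refl , refl)))) = from-L y≢y' (bound (inj₁ (refl , refl)))
    respects (bound (inj₁ (inj₂ b))) =
      from-L (λ { refl → y'∉ψ₁ (x∈p∪q⁺ (inj₁ (exVars⊆qVars ψ₁ (BindsEx⇒∈exVars ψ₁ b)))) })
             (bound (inj₂ (inj₁ b)))
    respects (bound (inj₂ (inj₁ (refl , refl)))) =
      DependsOnly-≗ (λ a → cong (λ f → f a) (update-≡ s y' (s y)))
                    (DependsOnly-mono (∩-reflexiveʳ (sym A≡)) (respectsL (bound (inj₁ (refl , refl)))))
    respects (bound (inj₂ (inj₂ b))) =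
      from-L (λ { refl → y'∉ψ₂ (x∈p∪q⁺ (inj₁ (exVars⊆qVars ψ₂ (BindsEx⇒∈exVars ψ₂ (BindsEx-χ⁻ b))))) })
             (bound (inj₂ (inj₂ (BindsEx-χ⁻ b))))
    respects {v = v} (free v∉R) = DependsOnly-≗ (s'≗s v≢y') (respectsL (free (v∉R ∘′ L⇒R-ex)))
      where
      v≢y' : v ≢ y'
      v≢y' refl = v∉R (x∈p∪q⁺ (inj₂ (x∈p∪q⁺ (inj₂ (x∈⁅x⁆ y')))))
      L⇒R-ex : v ∈ exVars L → v ∈ exVars R
      L⇒R-ex h with x∈p∪q⁻ (exVars ψ₁ ∪ exVars ψ₂) ⁅ y ⁆ h
      ... | inj₂ h' = x∈p∪q⁺ (inj₁ (x∈p∪q⁺ (inj₂ h')))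
      ... | inj₁ h' with x∈p∪q⁻ (exVars ψ₁) (exVars ψ₂) h'
      ...   | inj₁ h₁ = x∈p∪q⁺ (inj₁ (x∈p∪q⁺ (inj₁ h₁)))
      ...   | inj₂ h₂ = x∈p∪q⁺ (inj₂ (x∈p∪q⁺ (inj₁ (subst (_ ∈_) (sym Eχ≡) h₂))))

    pointwise : ∀ a {v} → v ≢ y' → extend (allVars R) s' a v ≡ extend (allVars L) s a v
    pointwise a v≢y' = extend-≡ s' a s a R⇒L L⇒R (λ _ → refl) (λ _ → s'≗s v≢y' a)

    holds-≡ : ∀ a → evalS R s' a ≡ evalS L s a
    holds-≡ a = cong₂ _∨_
      (evalF-cong ψ₁ λ v o → pointwise a (Occurs-∉occVars ψ₁ y'∉ψ₁ o))
      (by-renaming (trans (extend-∉ (allVars R) s' a y'∉R)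
                          (trans (cong (λ f → f a) (update-≡ s y' (s y)))
                                 (sym (extend-∉ (allVars L) s a y∉L))))
                   (λ o _ → pointwise a (Occurs-∉occVars φ₂ y'∉φ₂ o)))

  inR⇒ψ₁ : ∀ {u} → u ∈ allVars R → u ∉ qVars ψ₂ → u ∈ allVars ψ₁
  inR⇒ψ₁ h u∉ψ₂ with x∈p∪q⁻ (allVars ψ₁) (allVars χ) h
  ... | inj₁ h₁ = h₁
  ... | inj₂ h₂ = contradiction (allVars⊆qVars ψ₂ (subst (_ ∈_) Aχ≡ h₂)) u∉ψ₂
  inR⇒ψ₂ : ∀ {u} → u ∈ allVars R → u ∉ qVars ψ₁ → u ∈ allVars ψ₂
  inR⇒ψ₂ h u∉ψ₁ with x∈p∪q⁻ (allVars ψ₁) (allVars χ) h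
  ... | inj₁ h₁ = contradiction (allVars⊆qVars ψ₁ h₁) u∉ψ₁
  ... | inj₂ h₂ = subst (_ ∈_) Aχ≡ h₂

  from : Satisfiable R → Satisfiable L
  from (s , cand , holds) = case ∀-assignment? P₁ (λ a b a≗b → P₁-dep a b (λ u _ → a≗b u)) of λ
    { (inj₁ P₁-holds) →
        s , Respects⇒SkolemCand L (respects-with s (λ _ _ → refl)
                                     (R⇒L-∩ (respectsR (bound (inj₁ (inj₁ (refl , refl))))))) ,
        λ a → ∨-≡trueˡ (trans (evalF-cong ψ₁ λ v _ → extend-≡ s a s a L⇒R R⇒L (λ _ → refl) (λ _ → refl))
                               (P₁-holds a))
    ; (inj₂ (b₀ , P₁b₀)) →
        s' , Respects⇒SkolemCand L
               (respects-with s' s'≗s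
                  (DependsOnly-≗ s'y (R⇒L-∩ (respectsR (bound (inj₂ (inj₁ (refl , refl)))))))) ,
        λ a → ∨-≡trueʳ (ψ₂-holds b₀ P₁b₀ a)
    }
    where
    respectsR : Respects R s
    respectsR = SkolemCand⇒Respects R cand
    R⇒L-∩ : ∀ {f : BFun n} {E} → DependsOnly f (E ∩ allVars R) → DependsOnly f (E ∩ allVars L)
    R⇒L-∩ = DependsOnly-mono (∩-reflexiveʳ A≡)

    s-y'-constant : DependsOnly (s y') ∅
    s-y'-constant = DependsOnly-mono D∩R≡∅ (respectsR (bound (inj₂ (inj₁ (refl , refl)))))

    -- once one disjunct is false somewhere, the Skolem function of y' serves for y
    s' : Fin n → BFun n
    s' = s [ y ≔ s y' ]
    s'≗s : ∀ {v} → v ≢ y → ∀ a → s' v a ≡ s v a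
    s'≗s v≢y a = cong (λ f → f a) (update-≢ s (s y') v≢y)
    s'y : ∀ a → s' y a ≡ s y' a
    s'y a = cong (λ f → f a) (update-≡ s y (s y'))

    respects-with : ∀ t → (∀ {v} → v ≢ y → ∀ a → t v a ≡ s v a) →
                    DependsOnly (t y) (D ∩ allVars L) → Respects L t
    respects-with t t≗s t-y (bound (inj₁ (refl , refl))) = t-y
    respects-with t t≗s t-y (bound (inj₂ b)) =
      DependsOnly-≗ (t≗s λ { refl → y∉Q (exVars⊆qVars (or ψ₁ ψ₂) (BindsEx⇒∈exVars (or ψ₁ ψ₂) b)) })
        (R⇒L-∩ (respectsR (bound ([ inj₁ ∘′ inj₂ , inj₂ ∘′ inj₂ ∘′ BindsEx-χ⁺ ] b))))
    respects-with t t≗s t-y {v = v} (free v∉L) =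
      DependsOnly-≗ (t≗s λ { refl → v∉L (x∈p∪q⁺ (inj₂ (x∈⁅x⁆ y))) }) s-v
      where
      s-v : DependsOnly (s v) ∅
      s-v with v ≟ y'
      ... | yes refl = s-y'-constant
      ... | no v≢y'  = respectsR (free (v∉L ∘′ R⇒L-ex))
        where
        R⇒L-ex : v ∈ exVars R → v ∈ exVars L
        R⇒L-ex h with x∈p∪q⁻ (exVars ψ₁ ∪ ⁅ y ⁆) (exVars χ ∪ ⁅ y' ⁆) h
        ... | inj₁ h₁ = ∪-mono (x∈p∪q⁺ ∘′ inj₁) id h₁
        ... | inj₂ h₂ with x∈p∪q⁻ (exVars χ) ⁅ y' ⁆ h₂
        ...   | inj₁ h₃ = x∈p∪q⁺ (inj₁ (x∈p∪q⁺ (inj₂ (subst (_ ∈_) Eχ≡ h₃))))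
        ...   | inj₂ h₃ = contradiction (x∈⁅y⁆⇒x≡y y' h₃) v≢y'

    P₁ Q₂ : Assignment n → Bool
    P₁ a = evalF (extend (allVars R) s a) ψ₁
    Q₂ a = evalF (extend (allVars R) s a) χ

    P₁-dep : ∀ a b → Agree (allVars ψ₁) a b → P₁ a ≡ P₁ b
    P₁-dep a b a≈b = evalF-cong ψ₁ λ v o →
      extend-≡ s a s b id id (λ v∈R → a≈b v (inR⇒ψ₁ v∈R (Compatible-Occurs ψ₁ ψ₂ c₁₂ o)))
                             (λ _ → local o a b a≈b)
      where
      local : ∀ {v} → Occurs v ψ₁ → DependsOnly (s v) (allVars ψ₁)
      local o = Respects-DependsOnly R respectsR λ
        { (inj₁ (inj₁ (refl , refl))) → λ h → contradiction (D∩R≡∅ h) ∉⊥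
        ; (inj₁ (inj₂ b₁)) → λ h → let (u∈E , u∈R) = x∈p∩q⁻ _ _ h in
            inR⇒ψ₁ u∈R (Compatible-depVars ψ₁ ψ₂ c₁₂ (BindsEx⇒⊆depVars ψ₁ b₁ u∈E))
        ; (inj₂ (inj₁ (refl , refl))) → contradiction (Occurs⇒∈occVars ψ₁ o) y'∉ψ₁
        ; (inj₂ (inj₂ b₂)) →
            contradiction (exVars⊆qVars ψ₂ (BindsEx⇒∈exVars ψ₂ (BindsEx-χ⁻ b₂)))
                          (Compatible-Occurs ψ₁ ψ₂ c₁₂ o)
        }

    Q₂-dep : ∀ a b → Agree (allVars ψ₂) a b → Q₂ a ≡ Q₂ b
    Q₂-dep a b a≈b = trans (evalF-χ _) (trans (evalF-cong ψ₂ pointwise) (sym (evalF-χ _)))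
      where
      local : ∀ {v} → Occurs v ψ₂ → v ≢ y → DependsOnly (s v) (allVars ψ₂)
      local o v≢y = Respects-DependsOnly R respectsR λ
        { (inj₁ (inj₁ (refl , refl))) → contradiction refl v≢y
        ; (inj₁ (inj₂ b₁)) →
            contradiction (exVars⊆qVars ψ₁ (BindsEx⇒∈exVars ψ₁ b₁)) (Compatible-Occurs ψ₂ ψ₁ c₂₁ o)
        ; (inj₂ (inj₁ (refl , refl))) → contradiction (Occurs⇒∈occVars ψ₂ o) y'∉ψ₂
        ; (inj₂ (inj₂ b₂)) → λ h → let (u∈E , u∈R) = x∈p∩q⁻ _ _ h in
            inR⇒ψ₂ u∈R (Compatible-depVars ψ₂ ψ₁ c₂₁ (BindsEx⇒⊆depVars ψ₂ (BindsEx-χ⁻ b₂) u∈E))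
        }
      pointwise : ∀ v → Occurs v ψ₂ →
                  extend (allVars R) s a (renameVar y y' v) ≡ extend (allVars R) s b (renameVar y y' v)
      pointwise v o with v ≟ y
      ... | yes refl = trans (extend-∉ (allVars R) s a y'∉R)
                         (trans (constant s-y'-constant a b) (sym (extend-∉ (allVars R) s b y'∉R)))
      ... | no v≢y   = extend-≡ s a s b id id
                         (λ v∈R → a≈b v (inR⇒ψ₂ v∈R (Compatible-Occurs ψ₂ ψ₁ c₂₁ o)))
                         (λ _ → local o v≢y a b a≈b)

    ψ₂-holds : ∀ b₀ → P₁ b₀ ≡ false → ∀ a → evalF (extend (allVars L) s' a) ψ₂ ≡ true
    ψ₂-holds b₀ P₁b₀ a = begin
      evalF (extend (allVars L) s' a) ψ₂  ≡⟨ sym (by-renaming at-y elsewhere) ⟩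
      Q₂ a                                ≡⟨ Q₂-dep a a' a≈a' ⟩
      Q₂ a'                               ≡⟨ ∨-≡true-resolve P₁a'≡false (holds a') ⟩
      true                                ∎
      where
      open ≡-Reasoning
      -- b₀ on the universal variables of ψ₁, a elsewhere
      a' : Assignment n
      a' = extend (allVars ψ₁) (λ u _ → a u) b₀

      P₁a'≡false : P₁ a' ≡ false
      P₁a'≡false = trans (P₁-dep a' b₀ λ u → extend-∈ (allVars ψ₁) (λ u _ → a u) b₀) P₁b₀
      a≈a' : Agree (allVars ψ₂) a a'
      a≈a' u u∈ψ₂ = sym (extend-∉ (allVars ψ₁) (λ u _ → a u) b₀
                           (Compatible-qVars ψ₂ ψ₁ c₂₁ (allVars⊆qVars ψ₂ u∈ψ₂) ∘′ allVars⊆qVars ψ₁))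

      at-y : extend (allVars R) s a y' ≡ extend (allVars L) s' a y
      at-y = trans (extend-∉ (allVars R) s a y'∉R)
                   (trans (sym (s'y a)) (sym (extend-∉ (allVars L) s' a y∉L)))
      elsewhere : ∀ {v} → Occurs v φ₂ → v ≢ y → extend (allVars R) s a v ≡ extend (allVars L) s' a v
      elsewhere _ v≢y = extend-≡ s a s' a R⇒L L⇒R (λ _ → refl) (λ _ → sym (s'≗s v≢y a))

theorem3 : (n : ℕ) →
  -- (a) ∃y(D_y):φ ≡ φ
  (∀ (y : Fin n) (D : Subset n) (φ : DQBF n) →
    𝒟 (Ex y D φ) → 𝒟 φ →
    Ex y D φ ≃ φ) ×
  -- (b) ∀x:φ ≈ φ^(-x)  if x ∉ V_φ
  (∀ (x : Fin n) (φ : DQBF n) →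
    𝒟 (All x φ) → 𝒟 (removeDep x φ) →
    x ∉ occVars φ →
    All x φ ≈ removeDep x φ) ×
  -- (c) ∀x:φ ≡ φ[0/x] ∧ φ[1/x]  if V^∀_φ = V^∃_φ = ∅
  (∀ (x : Fin n) (φ : DQBF n) →
    𝒟 (All x φ) → 𝒟 (and (substConst x false φ) (substConst x true φ)) →
    Empty (allVars φ) → Empty (exVars φ) →
    All x φ ≃ and (substConst x false φ) (substConst x true φ)) ×
  -- (d) ∃y(D_y):φ ≈ φ[0/y] ∨ φ[1/y]  if V^∀_φ = V^∃_φ = ∅
  (∀ (y : Fin n) (D : Subset n) (φ : DQBF n) →
    𝒟 (Ex y D φ) → 𝒟 (or (substConst y false φ) (substConst y true φ)) →
    Empty (allVars φ) → Empty (exVars φ) →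
    Ex y D φ ≈ or (substConst y false φ) (substConst y true φ)) ×
  -- (e) ∀x:(φ₁ ∧ φ₂) ≈ (∀x:φ₁) ∧ (∀x':φ₂[x'/x]),  x' fresh
  (∀ (x x' : Fin n) (φ₁ φ₂ : DQBF n) →
    𝒟 (All x (and φ₁ φ₂)) → 𝒟 (and (All x φ₁) (All x' (rename x x' φ₂))) →
    x' ∉ occVars φ₁ → x' ∉ depVars φ₁ → x' ∉ occVars φ₂ → x' ∉ depVars φ₂ →
    All x (and φ₁ φ₂) ≈ and (All x φ₁) (All x' (rename x x' φ₂))) ×
  -- (f) ∀x:(φ₁ ∧ φ₂) ≈ φ₁^(-x) ∧ (∀x:φ₂)  if x ∉ V_φ₁
  (∀ (x : Fin n) (φ₁ φ₂ : DQBF n) →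
    𝒟 (All x (and φ₁ φ₂)) → 𝒟 (and (removeDep x φ₁) (All x φ₂)) →
    x ∉ occVars φ₁ →
    All x (and φ₁ φ₂) ≈ and (removeDep x φ₁) (All x φ₂)) ×
  -- (g) ∀x:(φ₁ ∘ φ₂) ≡ φ₁ ∘ (∀x:φ₂)  if x ∉ V_φ₁ and x ∉ D_y for all y ∈ V^∃_φ₁
  (∀ (∘ : Conn) (x : Fin n) (φ₁ φ₂ : DQBF n) →
    𝒟 (All x (conn ∘ φ₁ φ₂)) → 𝒟 (conn ∘ φ₁ (All x φ₂)) →
    x ∉ occVars φ₁ → x ∉ depVars φ₁ →
    All x (conn ∘ φ₁ φ₂) ≃ conn ∘ φ₁ (All x φ₂)) ×
  -- (h) ∃y(D_y):(φ₁ ∨ φ₂) ≈ (∃y(D_y):φ₁) ∨ (∃y'(D_y):φ₂[y'/y]),  y' fresh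
  (∀ (y y' : Fin n) (D : Subset n) (φ₁ φ₂ : DQBF n) →
    𝒟 (Ex y D (or φ₁ φ₂)) → 𝒟 (or (Ex y D φ₁) (Ex y' D (rename y y' φ₂))) →
    y' ∉ occVars φ₁ → y' ∉ depVars φ₁ → y' ∉ occVars φ₂ → y' ∉ depVars φ₂ →
    Ex y D (or φ₁ φ₂) ≈ or (Ex y D φ₁) (Ex y' D (rename y y' φ₂))) ×
  -- (i) ∃y(D_y):(φ₁ ∘ φ₂) ≡ φ₁ ∘ (∃y(D_y):φ₂)  if y ∉ V_φ₁
  (∀ (∘ : Conn) (y : Fin n) (D : Subset n) (φ₁ φ₂ : DQBF n) →
    𝒟 (Ex y D (conn ∘ φ₁ φ₂)) → 𝒟 (conn ∘ φ₁ (Ex y D φ₂)) →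
    y ∉ occVars φ₁ →
    Ex y D (conn ∘ φ₁ φ₂) ≃ conn ∘ φ₁ (Ex y D φ₂)) ×
  -- (j) ∃y₁(D_y₁) ∃y₂(D_y₂):φ ≡ ∃y₂(D_y₂) ∃y₁(D_y₁):φ
  (∀ (y₁ y₂ : Fin n) (D₁ D₂ : Subset n) (φ : DQBF n) →
    𝒟 (Ex y₁ D₁ (Ex y₂ D₂ φ)) → 𝒟 (Ex y₂ D₂ (Ex y₁ D₁ φ)) →
    Ex y₁ D₁ (Ex y₂ D₂ φ) ≃ Ex y₂ D₂ (Ex y₁ D₁ φ)) ×
  -- (k) ∀x₁ ∀x₂:φ ≡ ∀x₂ ∀x₁:φ
  (∀ (x₁ x₂ : Fin n) (φ : DQBF n) →
    𝒟 (All x₁ (All x₂ φ)) → 𝒟 (All x₂ (All x₁ φ)) →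
    All x₁ (All x₂ φ) ≃ All x₂ (All x₁ φ)) ×
  -- (l) ∀x ∃y(D_y):φ ≡ ∃y(D_y) ∀x:φ  if x ∉ D_y
  (∀ (x y : Fin n) (D : Subset n) (φ : DQBF n) →
    𝒟 (All x (Ex y D φ)) → 𝒟 (Ex y D (All x φ)) →
    x ∉ D →
    All x (Ex y D φ) ≃ Ex y D (All x φ))
theorem3 n =
  (λ y D φ d _ → let (y∉φ , D-fresh) = 𝒟-Ex⁻ d in ∃-drop y D φ y∉φ D-fresh) ,
  (λ x φ _ _ x∉φ → ∀-drop x φ x∉φ) ,
  (λ x φ _ _ noAll noEx → ∀-expand x φ noAll noEx) ,
  (λ y D φ _ _ noAll _ → ∃-expand y D φ noAll) ,
  (λ { x x' φ₁ φ₂ (d-all (d-and _ _ c₁₂ c₂₁) x∉φ) _ x'∉φ₁ x'∉D₁ x'∉φ₂ x'∉D₂ →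
       ∀-distrib-∧ x x' φ₁ φ₂ c₁₂ c₂₁ (x∉φ ∘′ ∪-mono (x∈p∪q⁺ ∘′ inj₂) (x∈p∪q⁺ ∘′ inj₂))
                   x'∉φ₁ x'∉D₁ x'∉φ₂ x'∉D₂ }) ,
  (λ { x φ₁ φ₂ (d-all (d-and _ _ c₁₂ c₂₁) _) _ x∉φ₁ → ∀-pushʳ-≈ x φ₁ φ₂ c₁₂ c₂₁ x∉φ₁ }) ,
  (λ ∘ x φ₁ φ₂ _ _ _ _ → ∀-pushʳ ∘ x φ₁ φ₂) ,
  (λ y y' D φ₁ φ₂ dL dR y'∉φ₁ _ y'∉φ₂ y'∉D₂ →
     ∃-distrib-∨ y y' D φ₁ φ₂ dL (𝒟-or-Ex⇒≢ dR) y'∉φ₁ y'∉φ₂ y'∉D₂) ,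
  (λ ∘ y D φ₁ φ₂ d _ _ → ∃-pushʳ ∘ y D φ₁ φ₂ (proj₁ (𝒟-Ex⁻ d) ∘′ allVars⊆qVars (conn ∘ φ₁ φ₂))) ,
  (λ y₁ y₂ D₁ D₂ φ d₁ d₂ → ∃-comm y₁ y₂ D₁ D₂ φ (𝒟-Ex-Ex⁻ d₁) (𝒟-Ex-Ex⁻ d₂)) ,
  (λ x₁ x₂ φ _ _ → ∀-comm x₁ x₂ φ) ,
  (λ x y D φ _ _ _ → ∀∃-comm x y D φ)
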